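{- Let $\mathcal H$ be a family of graphs. There exists a constant $c=c(\mathcal H)$ such that every $\mathcal H$-free graph $G$ has fewer than $c$ vertices $v$ with $\operatorname{sdeg}(v)\ge 2$ if and only if $\mathcal H\le\{K_n^*,\ nP_3,\ K_{1,n}^*\}$ for some positive integer $n$.
   Context: All graphs are finite, simple and undirected. For a vertex $v$ of $G$, $\operatorname{sdeg}(v)=c(G-v)-c(G)+1$, where $c(\cdot)$ is the number of connected components. For graphs $H_1,H_2$, write $H_1\prec H_2$ if $H_2$ contains an induced subgraph isomorphic to $H_1$. A graph $G$ is $\mathcal H$-free if no $H\in\mathcal H$ satisfies $H\prec G$. For families, $\mathcal H_1\le\mathcal H_2$ means for every $H_2\in\mathcal H_2$ there is $H_1\in\mathcal H_1$ with $H_1\prec H_2$. $P_3$ is the path on $3$ vertices and $nP_3$ the disjoint union of $n$ copies. $K_{1,n}^*$ is obtained from $K_{1,n}$ by attaching a pendant vertex to each leaf; $K_n^*$ from $K_n$ by attaching a pendant vertex to each vertex. -}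

module Defs where

open import Data.Nat using (ℕ; zero; suc; _+_; _*_; _∸_; _≤_; _<_; _≡ᵇ_; _<ᵇ_; _≤ᵇ_; _%_)
open import Data.Bool using (Bool; true; false; not; _∧_; _∨_)
open import Data.Bool.Properties using (∨-comm)
open import Data.Fin using (Fin; toℕ; punchIn)
open import Data.Fin.Properties using ()
open import Data.Product using (Σ; _×_; _,_)
open import Data.Sum using (_⊎_)
open import Function.Definitions using (Injective)
open import Relation.Nullary using (¬_)
open import Relation.Binary.PropositionalEquality using (_≡_; refl; cong; cong₂)

record Graph : Set where
  field
    n      : ℕ
    adj    : Fin n → Fin n → Bool
    sym    : ∀ i j → adj i j ≡ adj j i
    irrefl : ∀ i → adj i i ≡ false
open Graph public

anyF : ∀ {m} → (Fin m → Bool) → Bool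
anyF {zero}  p = false
anyF {suc m} p = p Fin.zero ∨ anyF (λ i → p (Fin.suc i))

allF : ∀ {m} → (Fin m → Bool) → Bool
allF {zero}  p = true
allF {suc m} p = p Fin.zero ∧ allF (λ i → p (Fin.suc i))

countF : ∀ {m} → (Fin m → Bool) → ℕ
countF {zero}  p = 0
countF {suc m} p = (if p Fin.zero then 1 else 0) + countF (λ i → p (Fin.suc i))
  where open import Data.Bool using (if_then_else_)

≡ᵇ-sym : ∀ a b → (a ≡ᵇ b) ≡ (b ≡ᵇ a)
≡ᵇ-sym zero    zero    = refl
≡ᵇ-sym zero    (suc b) = refl
≡ᵇ-sym (suc a) zero    = refl
≡ᵇ-sym (suc a) (suc b) = ≡ᵇ-sym a b

≡ᵇ-refl : ∀ a → (a ≡ᵇ a) ≡ true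
≡ᵇ-refl zero    = refl
≡ᵇ-refl (suc a) = ≡ᵇ-refl a

mkGraph : (m : ℕ) → (Fin m → Fin m → Bool) → Graph
mkGraph m E = record
  { n      = m
  ; adj    = A
  ; sym    = λ i j → cong₂ _∧_ (cong not (≡ᵇ-sym (toℕ i) (toℕ j)))
                               (∨-comm (E i j) (E j i))
  ; irrefl = λ i → irr i
  }
  where
  A : Fin m → Fin m → Bool
  A i j = not (toℕ i ≡ᵇ toℕ j) ∧ (E i j ∨ E j i)
  irr : ∀ i → A i i ≡ false
  irr i rewrite ≡ᵇ-refl (toℕ i) = refl

induced : (G : Graph) (m : ℕ) → (Fin m → Fin (n G)) → Graph
induced G m f = record
  { n      = m
  ; adj    = λ i j → adj G (f i) (f j)
  ; sym    = λ i j → sym G (f i) (f j)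
  ; irrefl = λ i → irrefl G (f i)
  }

pred : ℕ → ℕ
pred zero    = zero
pred (suc m) = m

skip : ∀ {m} → Fin m → Fin (pred m) → Fin m
skip {suc m} v i = punchIn v i

_−_ : (G : Graph) → Fin (n G) → Graph
G − v = induced G (pred (n G)) (skip v)

_≺_ : Graph → Graph → Set
H ≺ G = Σ (Fin (n H) → Fin (n G)) λ f →
          Injective _≡_ _≡_ f × (∀ i j → adj H i j ≡ adj G (f i) (f j))

reachWithin : (G : Graph) → ℕ → Fin (n G) → Fin (n G) → Bool
reachWithin G zero    u v = toℕ u ≡ᵇ toℕ v
reachWithin G (suc k) u v =
  reachWithin G k u v ∨ anyF (λ w → reachWithin G k u w ∧ adj G w v)

-- u and v lie in the same component (walks of length ≤ n suffice)
connected : (G : Graph) → Fin (n G) → Fin (n G) → Bool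
connected G = reachWithin G (n G)

-- c(G): number of connected components, counted as the number of
-- vertices that are the smallest vertex of their component
c : Graph → ℕ
c G = countF (λ v → allF (λ u → not ((toℕ u <ᵇ toℕ v) ∧ connected G u v)))

-- sdeg(v) = c(G - v) - c(G) + 1   (always ≥ 0)
sdeg : (G : Graph) → Fin (n G) → ℕ
sdeg G v = (c (G − v) + 1) ∸ c G

numSdeg≥2 : Graph → ℕ
numSdeg≥2 G = countF (λ v → 2 ≤ᵇ sdeg G v)

Family : Set₁
Family = Graph → Set

Free : Family → Graph → Set
Free ℋ G = ∀ H → ℋ H → ¬ (H ≺ G)

_≤F_ : Family → Family → Set
ℋ₁ ≤F ℋ₂ = ∀ H₂ → ℋ₂ H₂ → Σ Graph λ H₁ → ℋ₁ H₁ × (H₁ ≺ H₂)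

Triple : Graph → Graph → Graph → Family
Triple A B C G = (G ≡ A) ⊎ (G ≡ B) ⊎ (G ≡ C)

-- K_k^*: vertices 0..k-1 form K_k, vertex i+k is pendant at i
Kstar : ℕ → Graph
Kstar k = mkGraph (k + k) λ i j → E (toℕ i) (toℕ j)
  where
  E : ℕ → ℕ → Bool
  E a b = ((a <ᵇ k) ∧ (b <ᵇ k)) ∨ ((a <ᵇ k) ∧ (b ≡ᵇ a + k))

-- k P_3: paths 3t — 3t+1 — 3t+2 for t < k
kP3 : ℕ → Graph
kP3 k = mkGraph (k * 3) λ i j → E (toℕ i) (toℕ j)
  where
  E : ℕ → ℕ → Bool
  E a b = (b ≡ᵇ suc a) ∧ ((a % 3) <ᵇ 2)

-- K_{1,k}^*: centre 0, leaves 1..k, vertex a+k pendant at leaf a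
K1star : ℕ → Graph
K1star k = mkGraph (suc (k + k)) λ i j → E (toℕ i) (toℕ j)
  where
  E : ℕ → ℕ → Bool
  E a b = ((a ≡ᵇ 0) ∧ (0 <ᵇ b) ∧ (b <ᵇ suc k))
        ∨ ((0 <ᵇ a) ∧ (a <ᵇ suc k) ∧ (b ≡ᵇ a + k))

-- The graphs K_k^*, kP_3 and K_{1,k}^* each have at least k − 1 vertices v with sdeg v ≥ 2 (the
-- attachment vertices of pendant vertices), so if the ℋ-free graphs have boundedly many, every
-- such model graph with k large contains a member of ℋ (excluded middle turns "not ℋ-free"
-- into a witness).
--
-- Conversely, sdeg v ≥ 2 exactly when v separates two of its neighbours.  Among many such
-- cut vertices, either k are least vertices of distinct components, and paths a – v – b
-- through separated neighbours give kP_3; or many are inner, each with a neighbour below it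
-- (cut off by v from the least vertex of the component) and one above it.  "Below" is a tree
-- order, so Ramsey's theorem gives a long chain, hence kP_3, or a large antichain.  Further
-- Ramsey steps on the adjacencies among the antichain and its upper neighbours give a clique
-- with pendant lower neighbours (K_k^*), a common upper neighbour (K_{1,k}^*), a clique of upper
-- neighbours (K_k^*), or independent paths lower – v – upper (kP_3).

module Submission where

open import Defs renaming (sym to adj-symmetric)
open import Level using (0ℓ)
open import Axiom.ExcludedMiddle using (ExcludedMiddle)
open import Data.Bool using (Bool; true; false; _∧_; _∨_; not; T)
open import Data.Bool.Properties using () renaming (_≟_ to _≟ᵇ_)
open import Data.Empty using (⊥; ⊥-elim)
open import Data.Fin using (Fin; zero; suc; toℕ; fromℕ; inject₁; inject≤; punchOut; _↑ˡ_; _↑ʳ_; splitAt; combine; remQuot; _≟_)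
open import Data.Fin.Properties
  using (any?; toℕ-injective; toℕ<n; toℕ-fromℕ; toℕ-↑ˡ; toℕ-↑ʳ; toℕ-combine; injective⇒≤; inject≤-injective; inject₁-injective;
         fromℕ≢inject₁; punchInᵢ≢i; punchIn-injective; punchIn-punchOut; join-splitAt; splitAt-↑ˡ; splitAt-↑ʳ; ↑ˡ-injective;
         combine-remQuot; remQuot-combine)
  renaming (suc-injective to Fin-suc-injective)
open import Data.List using (List; []; _∷_; length; tabulate)
open import Data.List.Properties using (length-tabulate)
open import Data.List.Relation.Binary.Sublist.Propositional using (_⊆_; []; _∷_; _∷ʳ_; ⊆-trans; minimum)
open import Data.List.Relation.Binary.Sublist.Propositional.Properties using (All-resp-⊆)
open import Data.List.Relation.Unary.All using (All; []; _∷_)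
open import Data.List.Relation.Unary.AllPairs using (AllPairs; []; _∷_)
import Data.List.Relation.Unary.AllPairs.Properties as AllPairs
open import Data.Nat using (ℕ; zero; suc; _+_; _*_; _∸_; _%_; _≤_; _<_; z≤n; s≤s; _≤′_; ≤′-reflexive; ≤′-step; _≡ᵇ_; _<ᵇ_; _≤ᵇ_)
open import Data.Nat.DivMod using ([m+kn]%n≡m%n; m<n⇒m%n≡m)
open import Data.Nat.Properties
  using (≤-refl; ≤-trans; ≤-reflexive; ≤-pred; ≤⇒≤′; ≤⇒≯; <⇒≱; ≮⇒≥; <-trans; <-cmp; _<?_; ≤∧≢⇒<; n<1+n; 1+n≢n;
         m≤n⇒m≤1+n; m≤m+n; m≤n+m; 0∸n≡0; +-comm; +-suc; +-cancelˡ-≡; *-comm; *-monoˡ-≤; ∸-monoʳ-<;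
         ≡ᵇ⇒≡; ≡⇒≡ᵇ; <ᵇ⇒<; <⇒<ᵇ; ≤ᵇ⇒≤; ≤⇒≤ᵇ)
  renaming (suc-injective to ℕ-suc-injective)
open import Data.Product using (Σ; ∃; _×_; _,_; proj₁; proj₂; uncurry)
open import Data.Sum using (_⊎_; inj₁; inj₂; [_,_]′)
open import Data.Unit using (tt)
open import Function.Bundles using (_⇔_; mk⇔)
open import Relation.Binary.Definitions using (tri<; tri≈; tri>)
import Relation.Binary.Definitions as B
open import Relation.Binary.PropositionalEquality using (_≡_; _≢_; ≢-sym; refl; sym; trans; cong; cong₂; subst; subst₂)
open import Relation.Nullary using (¬_; Dec; yes; no)
open import Relation.Nullary.Decidable using (¬?; _×-dec_; decidable-stable)
open import Relation.Unary using (Pred; Decidable; _∩_; U; ∁)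

true≢false : true ≢ false
true≢false ()

≢true⇒≡false : ∀ {b} → b ≢ true → b ≡ false
≢true⇒≡false {false} _ = refl
≢true⇒≡false {true} h = ⊥-elim (h refl)

Bool-ext : ∀ {a b} → (a ≡ true → b ≡ true) → (b ≡ true → a ≡ true) → a ≡ b
Bool-ext {true}  {true}  _ _ = refl
Bool-ext {true}  {false} f _ = sym (f refl)
Bool-ext {false} {true}  _ g = g refl
Bool-ext {false} {false} _ _ = refl

∨-true-introˡ : ∀ a b → a ≡ true → a ∨ b ≡ true
∨-true-introˡ true _ _ = refl

∨-true-introʳ : ∀ a b → b ≡ true → a ∨ b ≡ true
∨-true-introʳ true  _ _ = refl
∨-true-introʳ false _ e = e

∨-true-elim : ∀ a b → a ∨ b ≡ true → a ≡ true ⊎ b ≡ true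
∨-true-elim true  _ _ = inj₁ refl
∨-true-elim false _ e = inj₂ e

∧-true-intro : ∀ a b → a ≡ true → b ≡ true → a ∧ b ≡ true
∧-true-intro true true _ _ = refl

∧-true-elimˡ : ∀ a b → a ∧ b ≡ true → a ≡ true
∧-true-elimˡ true _ _ = refl

∧-true-elimʳ : ∀ a b → a ∧ b ≡ true → b ≡ true
∧-true-elimʳ true _ e = e

not-true⇒false : ∀ a → not a ≡ true → a ≡ false
not-true⇒false false _ = refl

not-false⇒true : ∀ a → a ≡ false → not a ≡ true
not-false⇒true false _ = refl

T⇒≡true : ∀ {b} → T b → b ≡ true
T⇒≡true {true} _ = refl

≡true⇒T : ∀ {b} → b ≡ true → T b
≡true⇒T refl = tt

≡ᵇ-true⇒≡ : ∀ a b → (a ≡ᵇ b) ≡ true → a ≡ b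
≡ᵇ-true⇒≡ a b e = ≡ᵇ⇒≡ a b (≡true⇒T e)

≡⇒≡ᵇ-true : ∀ a b → a ≡ b → (a ≡ᵇ b) ≡ true
≡⇒≡ᵇ-true a b e = T⇒≡true (≡⇒≡ᵇ a b e)

≢⇒≡ᵇ-false : ∀ a b → a ≢ b → (a ≡ᵇ b) ≡ false
≢⇒≡ᵇ-false a b ne = ≢true⇒≡false (λ e → ne (≡ᵇ-true⇒≡ a b e))

<ᵇ-true⇒< : ∀ a b → (a <ᵇ b) ≡ true → a < b
<ᵇ-true⇒< a b e = <ᵇ⇒< a b (≡true⇒T e)

<⇒<ᵇ-true : ∀ a b → a < b → (a <ᵇ b) ≡ true
<⇒<ᵇ-true a b lt = T⇒≡true (<⇒<ᵇ lt)

≤ᵇ-true⇒≤ : ∀ a b → (a ≤ᵇ b) ≡ true → a ≤ b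
≤ᵇ-true⇒≤ a b e = ≤ᵇ⇒≤ a b (≡true⇒T e)

≤⇒≤ᵇ-true : ∀ a b → a ≤ b → (a ≤ᵇ b) ≡ true
≤⇒≤ᵇ-true a b le = T⇒≡true (≤⇒≤ᵇ le)

anyF-intro : ∀ {m} (p : Fin m → Bool) i → p i ≡ true → anyF p ≡ true
anyF-intro p zero    e = ∨-true-introˡ (p zero) _ e
anyF-intro p (suc i) e = ∨-true-introʳ (p zero) _ (anyF-intro (λ j → p (suc j)) i e)

anyF-elim : ∀ {m} (p : Fin m → Bool) → anyF p ≡ true → ∃ λ i → p i ≡ true
anyF-elim {suc m} p e with ∨-true-elim (p zero) _ e
... | inj₁ h = zero , h
... | inj₂ h with anyF-elim (λ j → p (suc j)) h
...   | i , q = suc i , q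

anyF-cong : ∀ {m} {p q : Fin m → Bool} → (∀ i → p i ≡ q i) → anyF p ≡ anyF q
anyF-cong {zero}  h = refl
anyF-cong {suc m} h = cong₂ _∨_ (h zero) (anyF-cong (λ i → h (suc i)))

allF-intro : ∀ {m} (p : Fin m → Bool) → (∀ i → p i ≡ true) → allF p ≡ true
allF-intro {zero}  p h = refl
allF-intro {suc m} p h = ∧-true-intro (p zero) _ (h zero) (allF-intro (λ j → p (suc j)) (λ i → h (suc i)))

allF-elim : ∀ {m} (p : Fin m → Bool) → allF p ≡ true → ∀ i → p i ≡ true
allF-elim p e zero    = ∧-true-elimˡ (p zero) _ e
allF-elim p e (suc i) = allF-elim (λ j → p (suc j)) (∧-true-elimʳ (p zero) _ e) i

allF-false : ∀ {m} (p : Fin m → Bool) → allF p ≡ false → ∃ λ i → p i ≡ false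
allF-false {suc m} p e with p zero in eq
... | false = zero , eq
... | true with allF-false (λ j → p (suc j)) e
...   | i , q = suc i , q

countF-≤ : ∀ {m} (p : Fin m → Bool) → countF p ≤ m
countF-≤ {zero}  p = z≤n
countF-≤ {suc m} p with p zero
... | true  = s≤s (countF-≤ (λ j → p (suc j)))
... | false = m≤n⇒m≤1+n (countF-≤ (λ j → p (suc j)))

countF-true : ∀ m → countF {m} (λ _ → true) ≡ m
countF-true zero    = refl
countF-true (suc m) = cong suc (countF-true m)

countF-split : ∀ {m} (p q : Fin m → Bool) →
  countF p ≡ countF (λ v → p v ∧ q v) + countF (λ v → p v ∧ not (q v))
countF-split {zero}  p q = refl
countF-split {suc m} p q with p zero | q zero | countF-split (λ v → p (suc v)) (λ v → q (suc v))
... | true  | true  | e = cong suc e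
... | true  | false | e = trans (cong suc e) (sym (+-suc _ _))
... | false | true  | e = e
... | false | false | e = e

enum : ∀ {m} (p : Fin m → Bool) → Fin (countF p) → Fin m
enum {suc m} p k with p zero
enum {suc m} p zero    | true = zero
enum {suc m} p (suc k) | true = suc (enum (λ j → p (suc j)) k)
enum {suc m} p k       | false = suc (enum (λ j → p (suc j)) k)

enum-sound : ∀ {m} (p : Fin m → Bool) k → p (enum p k) ≡ true
enum-sound {suc m} p k with p zero in eq
enum-sound {suc m} p zero    | true = eq
enum-sound {suc m} p (suc k) | true = enum-sound (λ j → p (suc j)) k
enum-sound {suc m} p k       | false = enum-sound (λ j → p (suc j)) k

enum-injective : ∀ {m} (p : Fin m → Bool) k l → enum p k ≡ enum p l → k ≡ l
enum-injective {suc m} p k l e with p zero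
enum-injective {suc m} p zero    zero    e  | true = refl
enum-injective {suc m} p (suc k) (suc l) e  | true = cong suc (enum-injective (λ j → p (suc j)) k l (Fin-suc-injective e))
enum-injective {suc m} p k       l       e  | false = enum-injective (λ j → p (suc j)) k l (Fin-suc-injective e)

rank : ∀ {m} (p : Fin m → Bool) i → p i ≡ true → Fin (countF p)
rank {suc m} p zero e with p zero
... | true = zero
rank {suc m} p (suc i) e with p zero
... | true  = suc (rank (λ j → p (suc j)) i e)
... | false = rank (λ j → p (suc j)) i e

enum-rank : ∀ {m} (p : Fin m → Bool) i (e : p i ≡ true) → enum p (rank p i e) ≡ i
enum-rank {suc m} p zero e with p zero
... | true = refl
enum-rank {suc m} p (suc i) e with p zero
... | true  = cong suc (enum-rank (λ j → p (suc j)) i e)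
... | false = cong suc (enum-rank (λ j → p (suc j)) i e)

countF-mono-injective : ∀ {m m′} (p : Fin m → Bool) (q : Fin m′ → Bool) (f : Fin m → Fin m′) →
  (∀ i → p i ≡ true → q (f i) ≡ true) →
  (∀ i j → p i ≡ true → p j ≡ true → f i ≡ f j → i ≡ j) →
  countF p ≤ countF q
countF-mono-injective p q f pq f-inj = injective⇒≤ {f = g} g-injective
  where
  g : Fin (countF p) → Fin (countF q)
  g k = rank q (f (enum p k)) (pq _ (enum-sound p k))
  g-injective : ∀ {k l} → g k ≡ g l → k ≡ l
  g-injective {k} {l} e = enum-injective p k l (f-inj _ _ (enum-sound p k) (enum-sound p l)
    (trans (sym (enum-rank q _ _)) (trans (cong (enum q) e) (enum-rank q _ _))))

countF-mono : ∀ {m} (p q : Fin m → Bool) → (∀ i → p i ≡ true → q i ≡ true) → countF p ≤ countF q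
countF-mono {zero}  p q h = z≤n
countF-mono {suc m} p q h with p zero in ep | q zero in eq
... | true  | true  = s≤s (countF-mono _ _ (λ i → h (suc i)))
... | true  | false = ⊥-elim (true≢false (trans (sym (h zero ep)) eq))
... | false | true  = m≤n⇒m≤1+n (countF-mono _ _ (λ i → h (suc i)))
... | false | false = countF-mono _ _ (λ i → h (suc i))

countF-mono-< : ∀ {m} (p q : Fin m → Bool) → (∀ i → p i ≡ true → q i ≡ true) →
  ∀ i → q i ≡ true → p i ≡ false → countF p < countF q
countF-mono-< {suc m} p q h zero qi pi with p zero | q zero
countF-mono-< {suc m} p q h zero refl refl | false | true = s≤s (countF-mono _ _ (λ i → h (suc i)))
countF-mono-< {suc m} p q h (suc i) qi pi with p zero in ep | q zero in eq
... | true  | true  = s≤s (countF-mono-< _ _ (λ i → h (suc i)) i qi pi)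
... | true  | false = ⊥-elim (true≢false (trans (sym (h zero ep)) eq))
... | false | true  = m≤n⇒m≤1+n (countF-mono-< _ _ (λ i → h (suc i)) i qi pi)
... | false | false = countF-mono-< _ _ (λ i → h (suc i)) i qi pi

countF-pos : ∀ {m} (p : Fin m → Bool) i → p i ≡ true → 1 ≤ countF p
countF-pos {suc m} p zero e with p zero
countF-pos {suc m} p zero refl | true = s≤s z≤n
countF-pos {suc m} p (suc i) e with p zero
... | true  = s≤s z≤n
... | false = countF-pos (λ j → p (suc j)) i e

pick : ∀ {m} (p : Fin m → Bool) k → k ≤ countF p →
  Σ (Fin k → Fin m) λ f → (∀ i → p (f i) ≡ true) × (∀ i j → f i ≡ f j → i ≡ j)
pick p k le = (λ i → enum p (inject≤ i le)) , (λ i → enum-sound p _) ,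
  (λ i j e → inject≤-injective le le i j (enum-injective p _ _ e))

-- Walks, connectivity and components

Vertex : Graph → Set
Vertex G = Fin (n G)

Adj : (G : Graph) → Vertex G → Vertex G → Set
Adj G u v = adj G u v ≡ true

Adj-sym : ∀ G {u v} → Adj G u v → Adj G v u
Adj-sym G {u} {v} e = trans (adj-symmetric G v u) e

Adj⇒≢ : ∀ G {u v} → Adj G u v → u ≢ v
Adj⇒≢ G {u} e refl = true≢false (trans (sym e) (irrefl G u))

Apart : (G : Graph) → Vertex G → Vertex G → Set
Apart G x y = x ≢ y × adj G x y ≡ false

apart-sym : ∀ G {x y} → Apart G x y → Apart G y x
apart-sym G {x} {y} (x≢y , x≁y) = ≢-sym x≢y , trans (adj-symmetric G y x) x≁y

data WalkIn (G : Graph) (P : Pred (Vertex G) 0ℓ) : Vertex G → Vertex G → Set where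
  here : ∀ {u} → P u → WalkIn G P u u
  step : ∀ {u w v} → WalkIn G P u w → Adj G w v → P v → WalkIn G P u v

Walk : (G : Graph) → Vertex G → Vertex G → Set
Walk G = WalkIn G U

Avoiding : (G : Graph) → Vertex G → Vertex G → Vertex G → Set
Avoiding G z = WalkIn G (_≢ z)

module _ {G : Graph} where

  walk-start : ∀ {P u v} → WalkIn G P u v → P u
  walk-start (here p)     = p
  walk-start (step w _ _) = walk-start w

  walk-end : ∀ {P u v} → WalkIn G P u v → P v
  walk-end (here p)     = p
  walk-end (step _ _ p) = p

  walk-edge : ∀ {P u v} → P u → Adj G u v → P v → WalkIn G P u v
  walk-edge pu e pv = step (here pu) e pv

  walk-++ : ∀ {P u w v} → WalkIn G P u w → WalkIn G P w v → WalkIn G P u v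
  walk-++ p (here _)     = p
  walk-++ p (step q e r) = step (walk-++ p q) e r

  walk-reverse : ∀ {P u v} → WalkIn G P u v → WalkIn G P v u
  walk-reverse (here p)     = here p
  walk-reverse (step w e p) = walk-++ (walk-edge p (Adj-sym G e) (walk-end w)) (walk-reverse w)

  walk-map : ∀ {P Q : Pred (Vertex G) 0ℓ} {u v} → (∀ {x} → P x → Q x) → WalkIn G P u v → WalkIn G Q u v
  walk-map f (here p)     = here (f p)
  walk-map f (step w e p) = step (walk-map f w) e (f p)

  walk-forget : ∀ {P u v} → WalkIn G P u v → Walk G u v
  walk-forget = walk-map (λ _ → tt)

  first-exit : ∀ {P Q : Pred (Vertex G) 0ℓ} {x y} → Decidable P → WalkIn G Q x y → P x →
    WalkIn G (P ∩ Q) x y ⊎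
    Σ (Vertex G) λ a → Σ (Vertex G) λ b → WalkIn G (P ∩ Q) x a × Adj G a b × ¬ P b × Q b
  first-exit P? (here q) px = inj₁ (here (px , q))
  first-exit P? (step {w = w} {v = v} p e qv) px with first-exit P? p px
  ... | inj₂ exit = inj₂ exit
  ... | inj₁ inside with P? v
  ...   | yes pv = inj₁ (step inside e (pv , qv))
  ...   | no ¬pv = inj₂ (w , v , inside , e , ¬pv , qv)

Conn : (G : Graph) → Vertex G → Vertex G → Set
Conn G u v = connected G u v ≡ true

module _ (G : Graph) where
  private
    R : ℕ → Vertex G → Vertex G → Bool
    R = reachWithin G

  reach⇒walk : ∀ k {u v} → R k u v ≡ true → Walk G u v
  reach⇒walk zero {u} e = subst (Walk G u) (toℕ-injective (≡ᵇ-true⇒≡ _ _ e)) (here tt)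
  reach⇒walk (suc k) {u} {v} e with ∨-true-elim _ _ e
  ... | inj₁ h = reach⇒walk k h
  ... | inj₂ h with anyF-elim (λ w → R k u w ∧ adj G w v) h
  ...   | w , q = step (reach⇒walk k (∧-true-elimˡ _ _ q)) (∧-true-elimʳ _ _ q) tt

  walk⇒reach : ∀ {u v} → Walk G u v → ∃ λ k → R k u v ≡ true
  walk⇒reach {u} (here _) = 0 , ≡⇒≡ᵇ-true (toℕ u) _ refl
  walk⇒reach {u} (step {w = w} p e _) with walk⇒reach p
  ... | k , h = suc k , ∨-true-introʳ _ _ (anyF-intro (λ x → R k u x ∧ adj G x _) w (∧-true-intro _ _ h e))

  reach-mono : ∀ {j k u v} → j ≤ k → R j u v ≡ true → R k u v ≡ true
  reach-mono le = go (≤⇒≤′ le)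
    where
    go : ∀ {j k u v} → j ≤′ k → R j u v ≡ true → R k u v ≡ true
    go (≤′-reflexive refl) e = e
    go (≤′-step le)        e = ∨-true-introˡ _ _ (go le e)

  Stable : Vertex G → ℕ → Set
  Stable u k = ∀ v → R (suc k) u v ≡ R k u v

  stable-suc : ∀ u k → Stable u k → Stable u (suc k)
  stable-suc u k st v = cong₂ _∨_ (st v) (anyF-cong (λ w → cong (_∧ adj G w v) (st w)))

  stable-+ : ∀ u j → Stable u j → ∀ d → Stable u (d + j)
  stable-+ u j st zero    = st
  stable-+ u j st (suc d) = stable-suc u (d + j) (stable-+ u j st d)

  stable-forever : ∀ u j → Stable u j → ∀ d v → R (d + j) u v ≡ R j u v
  stable-forever u j st zero    v = refl
  stable-forever u j st (suc d) v = trans (stable-+ u j st d v) (stable-forever u j st d v)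

  -- Until the reachable set from u stops growing, it gains a vertex at every step.
  stable-or-growing : ∀ u k → (∃ λ j → j ≤ k × Stable u j) ⊎ (k < countF (R k u))
  stable-or-growing u zero = inj₂ (countF-pos (R zero u) u (≡⇒≡ᵇ-true (toℕ u) _ refl))
  stable-or-growing u (suc k) with stable-or-growing u k
  ... | inj₁ (j , le , st) = inj₁ (j , m≤n⇒m≤1+n le , st)
  ... | inj₂ growing with allF (λ v → not (R (suc k) u v) ∨ R k u v) in eq
  ...   | true = inj₁ (k , m≤n⇒m≤1+n ≤-refl , λ v →
            Bool-ext (no-new (∨-true-elim _ _ (allF-elim _ eq v))) (∨-true-introˡ _ _))
    where
    no-new : ∀ {a b} → not a ≡ true ⊎ b ≡ true → a ≡ true → b ≡ true
    no-new {true} (inj₁ ()) _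
    no-new (inj₂ b) _ = b
  ...   | false with allF-false _ eq
  ...     | v , new = inj₂ (≤-trans (s≤s growing)
            (countF-mono-< (R k u) (R (suc k) u) (λ _ → ∨-true-introˡ _ _) v (reached new) (unreached new)))
    where
    reached : ∀ {a b} → (not a ∨ b) ≡ false → a ≡ true
    reached {true} _ = refl
    unreached : ∀ {a b} → (not a ∨ b) ≡ false → b ≡ false
    unreached {true} {false} _ = refl

  reach⇒conn : ∀ k {u v} → R k u v ≡ true → Conn G u v
  reach⇒conn k {u} {v} e with stable-or-growing u (n G)
  ... | inj₂ growing = ⊥-elim (≤⇒≯ (countF-≤ (R (n G) u)) growing)
  ... | inj₁ (j , le , st) =
    reach-mono le (subst (_≡ true) (stable-forever u j st k v) (reach-mono (m≤m+n k j) e))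

  walk⇒conn : ∀ {P u v} → WalkIn G P u v → Conn G u v
  walk⇒conn w with walk⇒reach (walk-forget w)
  ... | k , h = reach⇒conn k h

  conn⇒walk : ∀ {u v} → Conn G u v → Walk G u v
  conn⇒walk = reach⇒walk (n G)

  adj⇒conn : ∀ {u v} → Adj G u v → Conn G u v
  adj⇒conn e = walk⇒conn (walk-edge {P = U} tt e tt)

  conn-refl : ∀ u → Conn G u u
  conn-refl u = walk⇒conn (here {G = G} {P = U} {u = u} tt)

  conn-sym : ∀ {u v} → Conn G u v → Conn G v u
  conn-sym c = walk⇒conn (walk-reverse (conn⇒walk c))

  conn-trans : ∀ {u v w} → Conn G u v → Conn G v w → Conn G u w
  conn-trans c d = walk⇒conn (walk-++ (conn⇒walk c) (conn⇒walk d))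

least : ∀ {m} (p : Fin m → Bool) i → p i ≡ true →
  Σ (Fin m) λ j → p j ≡ true × (∀ k → toℕ k < toℕ j → p k ≡ false)
least {suc m} p i e with p zero in eq
... | true = zero , eq , λ _ ()
least {suc m} p zero e    | false = ⊥-elim (true≢false (trans (sym e) eq))
least {suc m} p (suc i) e | false with least (λ j → p (suc j)) i e
... | j , pj , below = suc j , pj , λ { zero _ → eq ; (suc k) (s≤s lt) → below k lt }

least-unique : ∀ {m} (p : Fin m → Bool) j₁ j₂ → p j₁ ≡ true → p j₂ ≡ true →
  (∀ k → toℕ k < toℕ j₁ → p k ≡ false) → (∀ k → toℕ k < toℕ j₂ → p k ≡ false) → j₁ ≡ j₂
least-unique p j₁ j₂ e₁ e₂ m₁ m₂ with <-cmp (toℕ j₁) (toℕ j₂)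
... | tri< lt _ _ = ⊥-elim (true≢false (trans (sym e₁) (m₂ j₁ lt)))
... | tri≈ _ eq _ = toℕ-injective eq
... | tri> _ _ gt = ⊥-elim (true≢false (trans (sym e₂) (m₁ j₂ gt)))

-- c G is, definitionally, countF (isRep G): isRep v says that v is the least vertex of its component.
isRep : (G : Graph) → Vertex G → Bool
isRep G v = allF (λ u → not ((toℕ u <ᵇ toℕ v) ∧ connected G u v))

module _ (G : Graph) where
  private
    least-conn : ∀ x → Σ (Vertex G) λ r → Conn G r x × (∀ k → toℕ k < toℕ r → connected G k x ≡ false)
    least-conn x = least (λ u → connected G u x) x (conn-refl G x)

  rep : Vertex G → Vertex G
  rep x = proj₁ (least-conn x)

  rep-conn : ∀ x → Conn G (rep x) x
  rep-conn x = proj₁ (proj₂ (least-conn x))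

  rep-minimal : ∀ x k → toℕ k < toℕ (rep x) → connected G k x ≡ false
  rep-minimal x = proj₂ (proj₂ (least-conn x))

  rep-isRep : ∀ x → isRep G (rep x) ≡ true
  rep-isRep x = allF-intro _ (λ u → not-false⇒true _ (≢true⇒≡false (λ h →
    true≢false (trans (sym (conn-trans G (∧-true-elimʳ _ _ h) (rep-conn x)))
                      (rep-minimal x u (<ᵇ-true⇒< _ _ (∧-true-elimˡ _ _ h)))))))

  rep-cong : ∀ {x y} → Conn G x y → rep x ≡ rep y
  rep-cong {x} {y} c = least-unique _ _ _ (rep-conn x) (conn-trans G (rep-conn y) (conn-sym G c))
    (rep-minimal x)
    (λ k lt → ≢true⇒≡false (λ h → true≢false (trans (sym (conn-trans G h c)) (rep-minimal y k lt))))

  rep≡⇒conn : ∀ {x y} → rep x ≡ rep y → Conn G x y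
  rep≡⇒conn {x} {y} e = conn-trans G (conn-sym G (rep-conn x)) (subst (λ t → Conn G t y) (sym e) (rep-conn y))

  isRep⇒rep≡ : ∀ r → isRep G r ≡ true → rep r ≡ r
  isRep⇒rep≡ r e with <-cmp (toℕ (rep r)) (toℕ r)
  ... | tri≈ _ eq _ = toℕ-injective eq
  ... | tri< lt _ _ = ⊥-elim (true≢false (trans (sym (∧-true-intro _ _ (<⇒<ᵇ-true _ _ lt) (rep-conn r)))
                        (not-true⇒false _ (allF-elim _ e (rep r)))))
  ... | tri> _ _ gt = ⊥-elim (true≢false (trans (sym (conn-refl G r)) (rep-minimal r r gt)))

  isRep-conn⇒≡ : ∀ {r s} → isRep G r ≡ true → isRep G s ≡ true → Conn G r s → r ≡ s
  isRep-conn⇒≡ {r} {s} er es c = trans (sym (isRep⇒rep≡ r er)) (trans (rep-cong c) (isRep⇒rep≡ s es))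

skip-≢ : ∀ {m} (z : Fin m) i → skip z i ≢ z
skip-≢ {suc m} z i = punchInᵢ≢i z i

skip-injective : ∀ {m} (z : Fin m) {i j} → skip z i ≡ skip z j → i ≡ j
skip-injective {suc m} z e = punchIn-injective z _ _ e

unskip : ∀ {m} (z : Fin m) x → x ≢ z → Σ (Fin (pred m)) λ i → skip z i ≡ x
unskip {suc m} z x ne = punchOut (≢-sym ne) , punchIn-punchOut (≢-sym ne)

module _ {G : Graph} {z : Vertex G} where

  minus⇒avoiding : ∀ {i j} → Walk (G − z) i j → Avoiding G z (skip z i) (skip z j)
  minus⇒avoiding {i} (here _)           = here (skip-≢ z i)
  minus⇒avoiding (step {v = v} p e _) = step (minus⇒avoiding p) e (skip-≢ z v)

  avoiding⇒minus : ∀ {x y} → Avoiding G z x y → ∀ {i j} → skip z i ≡ x → skip z j ≡ y → Walk (G − z) i j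
  avoiding⇒minus (here _) {i} refl ej = subst (Walk _ i) (skip-injective z (sym ej)) (here tt)
  avoiding⇒minus (step {w = w} p e _) ei refl with unskip z w (walk-end p)
  ... | l , refl = step (avoiding⇒minus p ei refl) e tt

module _ (G : Graph) (z : Vertex G) where

  conn-minus⇒avoiding : ∀ {i j} → Conn (G − z) i j → Avoiding G z (skip z i) (skip z j)
  conn-minus⇒avoiding c = minus⇒avoiding (conn⇒walk (G − z) c)

  avoiding⇒conn-minus : ∀ {i j} → Avoiding G z (skip z i) (skip z j) → Conn (G − z) i j
  avoiding⇒conn-minus p = walk⇒conn (G − z) (avoiding⇒minus p refl refl)

  conn-minus⇒conn : ∀ {i j} → Conn (G − z) i j → Conn G (skip z i) (skip z j)
  conn-minus⇒conn c = walk⇒conn G (conn-minus⇒avoiding c)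

  avoiding? : ∀ x y → Dec (Avoiding G z x y)
  avoiding? x y with x ≟ z | y ≟ z
  ... | yes x≡z | _ = no (λ p → walk-start p x≡z)
  ... | no _ | yes y≡z = no (λ p → walk-end p y≡z)
  ... | no x≢z | no y≢z with unskip z x x≢z | unskip z y y≢z
  ...   | i , refl | j , refl with connected (G − z) i j in c
  ...     | true  = yes (conn-minus⇒avoiding c)
  ...     | false = no (λ p → true≢false (trans (sym (avoiding⇒conn-minus p)) c))

-- Cut vertices

isCut? : (G : Graph) → Vertex G → Bool
isCut? G z = 2 ≤ᵇ sdeg G z

IsCut : (G : Graph) → Vertex G → Set
IsCut G z = isCut? G z ≡ true

Separates : (G : Graph) → Vertex G → Vertex G → Vertex G → Set
Separates G z a b = Adj G z a × Adj G z b × ¬ Avoiding G z a b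

separates⇒apart : ∀ G {z a b} → Separates G z a b → Apart G a b
separates⇒apart G {z} {a} {b} (za , zb , ¬joined) =
  (λ { refl → ¬joined (here a≢z) }) , ≢true⇒≡false (λ ab → ¬joined (walk-edge a≢z ab (Adj⇒≢ G (Adj-sym G zb))))
  where
  a≢z : a ≢ z
  a≢z = Adj⇒≢ G (Adj-sym G za)

2≤1+a∸b⇒b<a : ∀ a b → 2 ≤ (a + 1) ∸ b → b < a
2≤1+a∸b⇒b<a (suc a) zero    _ = s≤s z≤n
2≤1+a∸b⇒b<a zero    zero    (s≤s ())
2≤1+a∸b⇒b<a zero    (suc b) h = ⊥-elim (2≰0 (subst (2 ≤_) (0∸n≡0 b) h))
  where
  2≰0 : ¬ 2 ≤ 0
  2≰0 ()
2≤1+a∸b⇒b<a (suc a) (suc b) h = s≤s (2≤1+a∸b⇒b<a a b h)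

b<a⇒2≤1+a∸b : ∀ a b → b < a → 2 ≤ (a + 1) ∸ b
b<a⇒2≤1+a∸b (suc zero)    zero    _         = s≤s (s≤s z≤n)
b<a⇒2≤1+a∸b (suc (suc a)) zero    _         = s≤s (s≤s z≤n)
b<a⇒2≤1+a∸b (suc a)       (suc b) (s≤s b<a) = b<a⇒2≤1+a∸b a b b<a

module _ (G : Graph) (z : Vertex G) where

  avoid-until-z : ∀ {x y} → x ≢ z → Walk G x y →
    Avoiding G z x y ⊎ Σ (Vertex G) λ a → Avoiding G z x a × Adj G z a
  avoid-until-z x≢z w with first-exit (λ t → ¬? (t ≟ z)) w x≢z
  ... | inj₁ inside = inj₁ (walk-map proj₁ inside)
  ... | inj₂ (a , b , inside , ab , ¬b≢z , _) with decidable-stable (b ≟ z) ¬b≢z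
  ...   | refl = inj₂ (a , walk-map proj₁ inside , Adj-sym G ab)

  -- Route through the first and the last visit of the walk to a neighbour of z.
  reroute : (∀ {a b} → Adj G z a → Adj G z b → Avoiding G z a b) →
    ∀ {x y} → x ≢ z → y ≢ z → Walk G x y → Avoiding G z x y
  reroute joined x≢z y≢z w with avoid-until-z x≢z w | avoid-until-z y≢z (walk-reverse w)
  ... | inj₁ x→y | _ = x→y
  ... | inj₂ _ | inj₁ y→x = walk-reverse y→x
  ... | inj₂ (a , x→a , za) | inj₂ (b , y→b , zb) = walk-++ x→a (walk-++ (joined za zb) (walk-reverse y→b))

  c-minus≤c : (∀ {a b} → Adj G z a → Adj G z b → Avoiding G z a b) → c (G − z) ≤ c G
  c-minus≤c joined = countF-mono-injective (isRep (G − z)) (isRep G) (λ r → rep G (skip z r))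
    (λ r _ → rep-isRep G _)
    (λ r s er es same-rep → isRep-conn⇒≡ (G − z) er es (avoiding⇒conn-minus G z
      (reroute joined (skip-≢ z r) (skip-≢ z s) (conn⇒walk G (rep≡⇒conn G same-rep)))))

  module _ {a b} (za : Adj G z a) (zb : Adj G z b) (a↮b : ¬ Avoiding G z a b) where
    private
      a′ : Σ (Vertex (G − z)) λ i → skip z i ≡ a
      a′ = unskip z a (Adj⇒≢ G (Adj-sym G za))
      b′ : Σ (Vertex (G − z)) λ i → skip z i ≡ b
      b′ = unskip z b (Adj⇒≢ G (Adj-sym G zb))

      -- Each vertex of G is sent to a vertex of G − z in its G-component: the component
      -- of z is sent to a, every other vertex to itself.
      Image : Vertex G → Set
      Image x = Σ (Vertex (G − z)) λ i → (Conn G x z × i ≡ proj₁ a′) ⊎ (connected G x z ≡ false × skip z i ≡ x)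

      image : ∀ x → Image x
      image x = by-cases (connected G x z) refl
        where
        by-cases : ∀ b → connected G x z ≡ b → Image x
        by-cases true  xz  = proj₁ a′ , inj₁ (xz , refl)
        by-cases false x↮z = proj₁ (unskip z x x≢z) , inj₂ (x↮z , proj₂ (unskip z x x≢z))
          where
          x≢z : x ≢ z
          x≢z refl = true≢false (trans (sym (conn-refl G z)) x↮z)

      image-conn : ∀ x → Conn G (skip z (proj₁ (image x))) x
      image-conn x with image x
      ... | _ , inj₁ (xz , refl) = conn-trans G (subst (λ t → Conn G t z) (sym (proj₂ a′))
                                     (adj⇒conn G (Adj-sym G za)))
                                     (conn-sym G xz)
      ... | _ , inj₂ (_ , e) = subst (λ t → Conn G t x) (sym e) (conn-refl G x)

      b-apart : ∀ x → ¬ Conn (G − z) (proj₁ b′) (proj₁ (image x))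
      b-apart x c with image x | image-conn x
      ... | i , inj₁ (_ , refl) | _ =
        a↮b (walk-reverse (subst₂ (Avoiding G z) (proj₂ b′) (proj₂ a′) (conn-minus⇒avoiding G z c)))
      ... | i , inj₂ (x↮z , _) | ix = true≢false (trans (sym xz) x↮z)
        where
        xz : Conn G x z
        xz = conn-trans G (conn-sym G (conn-trans G (subst (λ t → Conn G t (skip z i)) (proj₂ b′)
               (conn-minus⇒conn G z c)) ix)) (adj⇒conn G (Adj-sym G zb))

      new-rep : Fin (suc (n G)) → Bool
      new-rep zero    = true
      new-rep (suc x) = isRep G x

      f : Fin (suc (n G)) → Vertex (G − z)
      f zero    = rep (G − z) (proj₁ b′)
      f (suc x) = rep (G − z) (proj₁ (image x))

      f-injective : ∀ u v → new-rep u ≡ true → new-rep v ≡ true → f u ≡ f v → u ≡ v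
      f-injective zero    zero    _ _ _ = refl
      f-injective zero    (suc y) _ _ e = ⊥-elim (b-apart y (rep≡⇒conn (G − z) e))
      f-injective (suc x) zero    _ _ e = ⊥-elim (b-apart x (rep≡⇒conn (G − z) (sym e)))
      f-injective (suc x) (suc y) ex ey e = cong suc (isRep-conn⇒≡ G ex ey
        (conn-trans G (conn-sym G (image-conn x))
          (conn-trans G (conn-minus⇒conn G z (rep≡⇒conn (G − z) e)) (image-conn y))))

    c<c-minus : c G < c (G − z)
    c<c-minus = countF-mono-injective new-rep (isRep (G − z)) f
      (λ { zero _ → rep-isRep (G − z) _ ; (suc x) _ → rep-isRep (G − z) _ }) f-injective

  isCut⇒separates : IsCut G z → Σ (Vertex G) λ a → Σ (Vertex G) λ b → Separates G z a b
  isCut⇒separates cut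
    with any? (λ a → any? λ b → (adj G z a ≟ᵇ true) ×-dec (adj G z b ≟ᵇ true) ×-dec ¬? (avoiding? G z a b))
  ... | yes separated = separated
  ... | no ¬separated = ⊥-elim (<⇒≱ (2≤1+a∸b⇒b<a _ _ (≤ᵇ-true⇒≤ 2 _ cut)) (c-minus≤c joined))
    where
    joined : ∀ {a b} → Adj G z a → Adj G z b → Avoiding G z a b
    joined {a} {b} za zb = decidable-stable (avoiding? G z a b) (λ ¬p → ¬separated (a , b , za , zb , ¬p))

  separates⇒isCut : ∀ {a b} → Separates G z a b → IsCut G z
  separates⇒isCut (za , zb , a↮b) = ≤⇒≤ᵇ-true 2 _ (b<a⇒2≤1+a∸b _ _ (c<c-minus za zb a↮b))

-- Ramsey's theorem for lists

module _ {A : Set} where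

  AllPairs-resp-⊆ : ∀ {R : A → A → Set} {xs ys} → xs ⊆ ys → AllPairs R ys → AllPairs R xs
  AllPairs-resp-⊆ []          []         = []
  AllPairs-resp-⊆ (_ ∷ʳ s)    (_ ∷ rs)   = AllPairs-resp-⊆ s rs
  AllPairs-resp-⊆ (refl ∷ s)  (r ∷ rs)   = All-resp-⊆ s r ∷ AllPairs-resp-⊆ s rs

  partition-⊆ : ∀ {P : Pred A 0ℓ} → Decidable P → (xs : List A) →
    Σ (List A) λ ts → Σ (List A) λ fs → ts ⊆ xs × fs ⊆ xs × All P ts × All (∁ P) fs ×
      length ts + length fs ≡ length xs
  partition-⊆ P? [] = [] , [] , [] , [] , [] , [] , refl
  partition-⊆ P? (x ∷ xs) with partition-⊆ P? xs | P? x
  ... | ts , fs , ts⊆ , fs⊆ , pts , ¬pfs , len | yes px =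
    x ∷ ts , fs , refl ∷ ts⊆ , x ∷ʳ fs⊆ , px ∷ pts , ¬pfs , cong suc len
  ... | ts , fs , ts⊆ , fs⊆ , pts , ¬pfs , len | no ¬px =
    ts , x ∷ fs , x ∷ʳ ts⊆ , refl ∷ fs⊆ , pts , ¬px ∷ ¬pfs , trans (+-suc (length ts) (length fs)) (cong suc len)

  Homogeneous : (A → A → Set) → ℕ → List A → Set
  Homogeneous R a xs = Σ (List A) λ ys → ys ⊆ xs × length ys ≡ a × AllPairs R ys

  homogeneous-⊆ : ∀ {R a xs ys} → xs ⊆ ys → Homogeneous R a xs → Homogeneous R a ys
  homogeneous-⊆ xs⊆ys (zs , zs⊆xs , len , hom) = zs , ⊆-trans zs⊆xs xs⊆ys , len , hom

ramseyBound : ℕ → ℕ → ℕ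
ramseyBound zero    b       = zero
ramseyBound (suc a) zero    = zero
ramseyBound (suc a) (suc b) = suc (ramseyBound a (suc b) + ramseyBound (suc a) b)

≤-+-split : ∀ {t f} r s → r + s ≤ t + f → r ≤ t ⊎ s ≤ f
≤-+-split zero s h = inj₁ z≤n
≤-+-split {zero}  {f} (suc r) s h = inj₂ (≤-trans (m≤n+m s (suc r)) h)
≤-+-split {suc t} (suc r) s (s≤s h) with ≤-+-split r s h
... | inj₁ r≤t = inj₁ (s≤s r≤t)
... | inj₂ s≤f = inj₂ s≤f

-- Pairs are tested as R x y with x before y in the list.
ramsey : ∀ {A : Set} {R : A → A → Set} → B.Decidable R → ∀ a b (xs : List A) →
  ramseyBound a b ≤ length xs → Homogeneous R a xs ⊎ Homogeneous (λ x y → ¬ R x y) b xs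
ramsey R? zero    b       xs h = inj₁ ([] , minimum xs , refl , [])
ramsey R? (suc a) zero    xs h = inj₂ ([] , minimum xs , refl , [])
ramsey R? (suc a) (suc b) (x ∷ xs) (s≤s h) with partition-⊆ (R? x) xs
... | ts , fs , ts⊆ , fs⊆ , rts , ¬rfs , len
  with ≤-+-split (ramseyBound a (suc b)) (ramseyBound (suc a) b) (subst (_ ≤_) (sym len) h)
...   | inj₁ ht with ramsey R? a (suc b) ts ht
...     | inj₁ (ys , ys⊆ , l , hom) = inj₁ (x ∷ ys , refl ∷ ⊆-trans ys⊆ ts⊆ , cong suc l , All-resp-⊆ ys⊆ rts ∷ hom)
...     | inj₂ hom = inj₂ (homogeneous-⊆ (x ∷ʳ ts⊆) hom)
ramsey R? (suc a) (suc b) (x ∷ xs) (s≤s h) | ts , fs , ts⊆ , fs⊆ , rts , ¬rfs , len | inj₂ hf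
  with ramsey R? (suc a) b fs hf
...     | inj₁ hom = inj₁ (homogeneous-⊆ (x ∷ʳ fs⊆) hom)
...     | inj₂ (ys , ys⊆ , l , hom) =
  inj₂ (x ∷ ys , refl ∷ ⊆-trans ys⊆ fs⊆ , cong suc l , All-resp-⊆ ys⊆ ¬rfs ∷ hom)

-- The i-th element of a list; d is only a filler for indices past its end.
nth : ∀ {A : Set} → A → List A → ℕ → A
nth d []       _       = d
nth d (x ∷ xs) zero    = x
nth d (x ∷ xs) (suc i) = nth d xs i

All-nth : ∀ {A : Set} {P : A → Set} {d xs} → All P xs → ∀ {j} → j < length xs → P (nth d xs j)
All-nth (px ∷ _)  {zero}  _         = px
All-nth (_ ∷ ps)  {suc j} (s≤s j<n) = All-nth ps j<n

AllPairs-nth : ∀ {A : Set} {R : A → A → Set} {d xs} → AllPairs R xs →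
  ∀ {i j} → i < j → j < length xs → R (nth d xs i) (nth d xs j)
AllPairs-nth (rx ∷ _)  {zero}  {suc j} _         (s≤s j<n) = All-nth rx j<n
AllPairs-nth (_ ∷ rs)  {suc i} {suc j} (s≤s i<j) (s≤s j<n) = AllPairs-nth rs i<j j<n

-- Recognising the model graphs

≺-intro : ∀ {H G} (f : Vertex H → Vertex G) → (∀ {i j} → i ≢ j → f i ≢ f j) →
  (∀ {i j} → i ≢ j → adj H i j ≡ adj G (f i) (f j)) → H ≺ G
≺-intro {H} {G} f f-distinct f-adj = f , injective , adj-≡
  where
  injective : ∀ {i j} → f i ≡ f j → i ≡ j
  injective {i} {j} e with i ≟ j
  ... | yes i≡j = i≡j
  ... | no  i≢j = ⊥-elim (f-distinct i≢j e)
  adj-≡ : ∀ i j → adj H i j ≡ adj G (f i) (f j)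
  adj-≡ i j with i ≟ j
  ... | yes refl = trans (irrefl H i) (sym (irrefl G (f i)))
  ... | no  i≢j = f-adj i≢j

≺-trans : ∀ {H X G} → H ≺ X → X ≺ G → H ≺ G
≺-trans (f , f-inj , f-adj) (g , g-inj , g-adj) =
  (λ i → g (f i)) , (λ e → f-inj (g-inj e)) , (λ i j → trans (f-adj i j) (g-adj (f i) (f j)))

adj-sym-≡ : ∀ H G (i j : Vertex H) {x y : Vertex G} →
  adj H i j ≡ adj G x y → adj H j i ≡ adj G y x
adj-sym-≡ H G i j e = trans (adj-symmetric H _ _) (trans e (adj-symmetric G _ _))

-- adj (Kstar k) and adj (K1star k) are, definitionally, the Boolean formulas below applied to
-- the comparisons of vertex numbers made by their defining relations; the model lemmas
-- evaluate them by case analysis on those comparisons, found by unification.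

kstar-formula : Bool → Bool → Bool → Bool → Bool → Bool
kstar-formula i<k j<k i=j j=i+k i=j+k = not i=j ∧ (((i<k ∧ j<k) ∨ (i<k ∧ j=i+k)) ∨ ((j<k ∧ i<k) ∨ (j<k ∧ i=j+k)))

module KstarModel (k : ℕ) where

  data View : Fin (k + k) → Set where
    at-core    : (a : Fin k) → View (a ↑ˡ k)
    at-pendant : (a : Fin k) → View (k ↑ʳ a)

  view : ∀ i → View i
  view i with splitAt k i | join-splitAt k k i
  ... | inj₁ a | refl = at-core a
  ... | inj₂ a | refl = at-pendant a

  core<k : ∀ (a : Fin k) → (toℕ (a ↑ˡ k) <ᵇ k) ≡ true
  core<k a = <⇒<ᵇ-true _ _ (subst (_< k) (sym (toℕ-↑ˡ a k)) (toℕ<n a))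

  pendant≮k : ∀ (a : Fin k) → (toℕ (k ↑ʳ a) <ᵇ k) ≡ false
  pendant≮k a = ≢true⇒≡false λ e →
    ≤⇒≯ (subst (k ≤_) (sym (toℕ-↑ʳ k a)) (m≤m+n k (toℕ a))) (<ᵇ-true⇒< _ _ e)

  core≢pendant : ∀ (a b : Fin k) → (toℕ (a ↑ˡ k) ≡ᵇ toℕ (k ↑ʳ b)) ≡ false
  core≢pendant a b = ≢⇒≡ᵇ-false _ _ (λ e → true≢false (trans (sym (core<k a)) (trans (cong (_<ᵇ k) e) (pendant≮k b))))

  pendant-of⇒≡ : ∀ (a b : Fin k) → (toℕ (k ↑ʳ b) ≡ᵇ toℕ (a ↑ˡ k) + k) ≡ true → a ≡ b
  pendant-of⇒≡ a b e = sym (toℕ-injective (+-cancelˡ-≡ k _ _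
     (trans (sym (toℕ-↑ʳ k b)) (trans (≡ᵇ-true⇒≡ _ _ e) (trans (cong (_+ k) (toℕ-↑ˡ a k)) (+-comm (toℕ a) k))))))

  pendant-of : ∀ (a : Fin k) → (toℕ (k ↑ʳ a) ≡ᵇ toℕ (a ↑ˡ k) + k) ≡ true
  pendant-of a = ≡⇒≡ᵇ-true _ _ (trans (toℕ-↑ʳ k a) (trans (+-comm k (toℕ a)) (cong (_+ k) (sym (toℕ-↑ˡ a k)))))

  core-core : ∀ a b → a ≢ b → adj (Kstar k) (a ↑ˡ k) (b ↑ˡ k) ≡ true
  core-core a b a≢b = evaluate _ _ _ _ _ (core<k a) (core<k b)
    (≢⇒≡ᵇ-false _ _ (λ e → a≢b (↑ˡ-injective k a b (toℕ-injective e))))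
    where
    evaluate : ∀ i<k j<k i=j j=i+k i=j+k → i<k ≡ true → j<k ≡ true → i=j ≡ false →
      kstar-formula i<k j<k i=j j=i+k i=j+k ≡ true
    evaluate true true false _ _ refl refl refl = refl

  core-pendant : ∀ a b → adj (Kstar k) (a ↑ˡ k) (k ↑ʳ b) ≡ (toℕ (k ↑ʳ b) ≡ᵇ toℕ (a ↑ˡ k) + k)
  core-pendant a b = evaluate _ _ _ _ _ (core<k a) (pendant≮k b) (core≢pendant a b)
    where
    evaluate : ∀ i<k j<k i=j j=i+k i=j+k → i<k ≡ true → j<k ≡ false → i=j ≡ false →
      kstar-formula i<k j<k i=j j=i+k i=j+k ≡ j=i+k
    evaluate true false false true  _ refl refl refl = refl
    evaluate true false false false _ refl refl refl = refl

  pendant-pendant : ∀ a b → adj (Kstar k) (k ↑ʳ a) (k ↑ʳ b) ≡ false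
  pendant-pendant a b = evaluate _ _ _ _ _ (pendant≮k a) (pendant≮k b)
    where
    evaluate : ∀ i<k j<k i=j j=i+k i=j+k → i<k ≡ false → j<k ≡ false →
      kstar-formula i<k j<k i=j j=i+k i=j+k ≡ false
    evaluate false false true  _ _ refl refl = refl
    evaluate false false false _ _ refl refl = refl

module KstarEmbedding (k : ℕ) (G : Graph) (core pendant : Fin k → Vertex G)
  (core-core : ∀ {a b} → a ≢ b → Adj G (core a) (core b))
  (core-pendant : ∀ a → Adj G (core a) (pendant a))
  (core-pendant′ : ∀ {a b} → a ≢ b → Apart G (core a) (pendant b))
  (pendant-pendant : ∀ {a b} → a ≢ b → Apart G (pendant a) (pendant b)) where

  open KstarModel k using (View; view; at-core; at-pendant)
  module M = KstarModel k

  f : Fin (k + k) → Vertex G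
  f i = [ core , pendant ]′ (splitAt k i)

  f-core : ∀ a → f (a ↑ˡ k) ≡ core a
  f-core a = cong [ core , pendant ]′ (splitAt-↑ˡ k a k)

  f-pendant : ∀ a → f (k ↑ʳ a) ≡ pendant a
  f-pendant a = cong [ core , pendant ]′ (splitAt-↑ʳ k k a)

  core≢pendant : ∀ a b → core a ≢ pendant b
  core≢pendant a b with a ≟ b
  ... | yes refl = Adj⇒≢ G (core-pendant a)
  ... | no  a≢b  = proj₁ (core-pendant′ a≢b)

  core-pendant-≡ : ∀ a b → adj (Kstar k) (a ↑ˡ k) (k ↑ʳ b) ≡ adj G (f (a ↑ˡ k)) (f (k ↑ʳ b))
  core-pendant-≡ a b rewrite f-core a | f-pendant b with a ≟ b
  ... | yes refl = trans (M.core-pendant a a) (trans (M.pendant-of a) (sym (core-pendant a)))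
  ... | no  a≢b  = trans (≢true⇒≡false (λ e → a≢b (M.pendant-of⇒≡ a b (trans (sym (M.core-pendant a b)) e))))
                         (sym (proj₂ (core-pendant′ a≢b)))

  distinct : ∀ {i j} → i ≢ j → f i ≢ f j
  distinct {i} {j} i≢j with view i | view j
  ... | at-core a | at-core b rewrite f-core a | f-core b = Adj⇒≢ G (core-core λ { refl → i≢j refl })
  ... | at-core a | at-pendant b rewrite f-core a | f-pendant b = core≢pendant a b
  ... | at-pendant a | at-core b rewrite f-pendant a | f-core b = ≢-sym (core≢pendant b a)
  ... | at-pendant a | at-pendant b rewrite f-pendant a | f-pendant b = proj₁ (pendant-pendant λ { refl → i≢j refl })

  adjacency : ∀ {i j} → i ≢ j → adj (Kstar k) i j ≡ adj G (f i) (f j)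
  adjacency {i} {j} i≢j with view i | view j
  ... | at-core a | at-core b rewrite f-core a | f-core b =
    trans (M.core-core a b λ { refl → i≢j refl }) (sym (core-core λ { refl → i≢j refl }))
  ... | at-core a | at-pendant b = core-pendant-≡ a b
  ... | at-pendant a | at-core b = adj-sym-≡ (Kstar k) G _ _ (core-pendant-≡ b a)
  ... | at-pendant a | at-pendant b rewrite f-pendant a | f-pendant b =
    trans (M.pendant-pendant a b) (sym (proj₂ (pendant-pendant λ { refl → i≢j refl })))

  embedding : Kstar k ≺ G
  embedding = ≺-intro {Kstar k} {G} f distinct adjacency

k1star-formula : Bool → Bool → Bool → Bool → Bool → Bool → Bool → Bool → Bool → Bool → Bool → Bool → Bool → Bool
k1star-formula i=j i=0 0<j j≤k 0<i i≤k j=i+k j=0 0<i′ i≤k′ 0<j′ j≤k′ i=j+k =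
  not i=j ∧ (((i=0 ∧ (0<j ∧ j≤k)) ∨ (0<i ∧ (i≤k ∧ j=i+k)))
           ∨ ((j=0 ∧ (0<i′ ∧ i≤k′)) ∨ (0<j′ ∧ (j≤k′ ∧ i=j+k))))

module K1starModel (k : ℕ) where
  open KstarModel k using (core<k; pendant≮k; core≢pendant; pendant-of; pendant-of⇒≡)
    renaming (View to KView; view to kview)
  open KstarModel.View

  leaf pendant : Fin k → Fin (suc (k + k))
  leaf    a = suc (a ↑ˡ k)
  pendant a = suc (k ↑ʳ a)

  data View : Fin (suc (k + k)) → Set where
    at-hub     : View zero
    at-leaf    : (a : Fin k) → View (leaf a)
    at-pendant : (a : Fin k) → View (pendant a)

  view : ∀ i → View i
  view zero = at-hub
  view (suc i) with kview i
  ... | at-core a    = at-leaf a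
  ... | at-pendant a = at-pendant a

  hub-leaf : ∀ a → adj (K1star k) zero (leaf a) ≡ true
  hub-leaf a = evaluate _ _ (core<k a)
    where
    evaluate : ∀ j≤k i=j+k → j≤k ≡ true →
      k1star-formula false true true j≤k false false false false false false true j≤k i=j+k ≡ true
    evaluate true _ refl = refl

  hub-pendant : ∀ a → adj (K1star k) zero (pendant a) ≡ false
  hub-pendant a = evaluate _ _ (pendant≮k a)
    where
    evaluate : ∀ j≤k i=j+k → j≤k ≡ false →
      k1star-formula false true true j≤k false false false false true j≤k true j≤k i=j+k ≡ false
    evaluate false _ refl = refl

  leaf-leaf : ∀ a b → adj (K1star k) (leaf a) (leaf b) ≡ false
  leaf-leaf a b = evaluate _ _ _ _ _ (core<k a) (core<k b) (not-pendant a b) (not-pendant b a)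
    where
    not-pendant : ∀ (a b : Fin k) → (suc (toℕ (b ↑ˡ k)) ≡ᵇ suc (toℕ (a ↑ˡ k)) + k) ≡ false
    not-pendant a b = ≢⇒≡ᵇ-false _ _ (λ e → ≤⇒≯ (subst (k ≤_) (sym (ℕ-suc-injective e)) (m≤n+m k _))
                                                (<ᵇ-true⇒< _ _ (core<k b)))
    evaluate : ∀ i=j i≤k j=i+k j≤k i=j+k → i≤k ≡ true → j≤k ≡ true → j=i+k ≡ false → i=j+k ≡ false →
      k1star-formula i=j false true true true i≤k j=i+k false true j≤k true j≤k i=j+k ≡ false
    evaluate true  _    _     _    _     _    _    _    _    = refl
    evaluate false true false true false refl refl refl refl = refl

  leaf-pendant : ∀ a b → adj (K1star k) (leaf a) (pendant b) ≡ (toℕ (k ↑ʳ b) ≡ᵇ toℕ (a ↑ˡ k) + k)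
  leaf-pendant a b = evaluate _ _ _ _ _ (core≢pendant a b) (core<k a) (pendant≮k b)
    where
    evaluate : ∀ i=j i≤k j=i+k j≤k i=j+k → i=j ≡ false → i≤k ≡ true → j≤k ≡ false →
      k1star-formula i=j false true j≤k true i≤k j=i+k false true i≤k true j≤k i=j+k ≡ j=i+k
    evaluate false true true  false _ refl refl refl = refl
    evaluate false true false false _ refl refl refl = refl

  pendant-pendant : ∀ a b → adj (K1star k) (pendant a) (pendant b) ≡ false
  pendant-pendant a b = evaluate _ _ _ _ _ (pendant≮k a) (pendant≮k b)
    where
    evaluate : ∀ i=j i≤k j=i+k j≤k i=j+k → i≤k ≡ false → j≤k ≡ false →
      k1star-formula i=j false true j≤k true i≤k j=i+k false true i≤k true j≤k i=j+k ≡ false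
    evaluate true  _     _ _     _ _    _    = refl
    evaluate false false _ false _ refl refl = refl

module K1starEmbedding (k : ℕ) (G : Graph) (hub : Vertex G) (leaf pendant : Fin k → Vertex G)
  (hub-leaf : ∀ a → Adj G hub (leaf a))
  (hub-pendant : ∀ a → Apart G hub (pendant a))
  (leaf-leaf : ∀ {a b} → a ≢ b → Apart G (leaf a) (leaf b))
  (leaf-pendant : ∀ a → Adj G (leaf a) (pendant a))
  (leaf-pendant′ : ∀ {a b} → a ≢ b → Apart G (leaf a) (pendant b))
  (pendant-pendant : ∀ {a b} → a ≢ b → Apart G (pendant a) (pendant b)) where

  open K1starModel k using (View; view; at-hub; at-leaf; at-pendant)
  module M = K1starModel k

  f : Fin (suc (k + k)) → Vertex G
  f zero    = hub
  f (suc i) = [ leaf , pendant ]′ (splitAt k i)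

  f-leaf : ∀ a → f (M.leaf a) ≡ leaf a
  f-leaf a = cong [ leaf , pendant ]′ (splitAt-↑ˡ k a k)

  f-pendant : ∀ a → f (M.pendant a) ≡ pendant a
  f-pendant a = cong [ leaf , pendant ]′ (splitAt-↑ʳ k k a)

  leaf≢pendant : ∀ a b → leaf a ≢ pendant b
  leaf≢pendant a b with a ≟ b
  ... | yes refl = Adj⇒≢ G (leaf-pendant a)
  ... | no  a≢b  = proj₁ (leaf-pendant′ a≢b)

  leaf-pendant-≡ : ∀ a b → adj (K1star k) (M.leaf a) (M.pendant b) ≡ adj G (f (M.leaf a)) (f (M.pendant b))
  leaf-pendant-≡ a b rewrite f-leaf a | f-pendant b with a ≟ b
  ... | yes refl = trans (M.leaf-pendant a a) (trans (KstarModel.pendant-of k a) (sym (leaf-pendant a)))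
  ... | no  a≢b  = trans (≢true⇒≡false (λ e → a≢b (KstarModel.pendant-of⇒≡ k a b (trans (sym (M.leaf-pendant a b)) e))))
                         (sym (proj₂ (leaf-pendant′ a≢b)))

  distinct : ∀ {i j} → i ≢ j → f i ≢ f j
  distinct {i} {j} i≢j with view i | view j
  ... | at-hub | at-hub = ⊥-elim (i≢j refl)
  ... | at-hub | at-leaf b rewrite f-leaf b = Adj⇒≢ G (hub-leaf b)
  ... | at-hub | at-pendant b rewrite f-pendant b = proj₁ (hub-pendant b)
  ... | at-leaf a | at-hub rewrite f-leaf a = ≢-sym (Adj⇒≢ G (hub-leaf a))
  ... | at-pendant a | at-hub rewrite f-pendant a = ≢-sym (proj₁ (hub-pendant a))
  ... | at-leaf a | at-leaf b rewrite f-leaf a | f-leaf b = proj₁ (leaf-leaf λ { refl → i≢j refl })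
  ... | at-leaf a | at-pendant b rewrite f-leaf a | f-pendant b = leaf≢pendant a b
  ... | at-pendant a | at-leaf b rewrite f-pendant a | f-leaf b = ≢-sym (leaf≢pendant b a)
  ... | at-pendant a | at-pendant b rewrite f-pendant a | f-pendant b = proj₁ (pendant-pendant λ { refl → i≢j refl })

  adjacency : ∀ {i j} → i ≢ j → adj (K1star k) i j ≡ adj G (f i) (f j)
  adjacency {i} {j} i≢j with view i | view j
  ... | at-hub | at-hub = ⊥-elim (i≢j refl)
  ... | at-hub | at-leaf b rewrite f-leaf b = trans (M.hub-leaf b) (sym (hub-leaf b))
  ... | at-hub | at-pendant b rewrite f-pendant b = trans (M.hub-pendant b) (sym (proj₂ (hub-pendant b)))
  ... | at-leaf a | at-hub rewrite f-leaf a =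
    adj-sym-≡ (K1star k) G zero (M.leaf a) (trans (M.hub-leaf a) (sym (hub-leaf a)))
  ... | at-pendant a | at-hub rewrite f-pendant a =
    adj-sym-≡ (K1star k) G zero (M.pendant a) (trans (M.hub-pendant a) (sym (proj₂ (hub-pendant a))))
  ... | at-leaf a | at-leaf b rewrite f-leaf a | f-leaf b =
    trans (M.leaf-leaf a b) (sym (proj₂ (leaf-leaf λ { refl → i≢j refl })))
  ... | at-leaf a | at-pendant b = leaf-pendant-≡ a b
  ... | at-pendant a | at-leaf b = adj-sym-≡ (K1star k) G (M.leaf b) (M.pendant a) (leaf-pendant-≡ b a)
  ... | at-pendant a | at-pendant b rewrite f-pendant a | f-pendant b =
    trans (M.pendant-pendant a b) (sym (proj₂ (pendant-pendant λ { refl → i≢j refl })))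

  embedding : K1star k ≺ G
  embedding = ≺-intro {K1star k} {G} f distinct adjacency

divmod3-unique : ∀ q q′ r s → r < 3 → s < 3 → q * 3 + r ≡ q′ * 3 + s → q ≡ q′ × r ≡ s
divmod3-unique zero    zero     r s _ _ e = refl , e
divmod3-unique zero    (suc q′) r s (s≤s (s≤s (s≤s ()))) _ refl
divmod3-unique (suc q) zero     r s _ (s≤s (s≤s (s≤s ()))) refl
divmod3-unique (suc q) (suc q′) r s r<3 s<3 e
  with divmod3-unique q q′ r s r<3 s<3 (ℕ-suc-injective (ℕ-suc-injective (ℕ-suc-injective e)))
... | refl , r≡s = refl , r≡s

[q*3+r]%3≡r : ∀ q r → r < 3 → (q * 3 + r) % 3 ≡ r
[q*3+r]%3≡r q r r<3 = trans (cong (_% 3) (+-comm (q * 3) r)) (trans ([m+kn]%n≡m%n r q 3) (m<n⇒m%n≡m r<3))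

-- The relation whose symmetric closure is the adjacency of kP3 (definitionally).
path-step : ℕ → ℕ → Bool
path-step a b = (b ≡ᵇ suc a) ∧ ((a % 3) <ᵇ 2)

path-step⇒ : ∀ q q′ r s → r < 3 → s < 3 → path-step (q * 3 + r) (q′ * 3 + s) ≡ true → q ≡ q′ × s ≡ suc r
path-step⇒ q q′ r s r<3 s<3 e
  with divmod3-unique q′ q s (suc r) s<3 (s≤s r<2) (trans (≡ᵇ-true⇒≡ _ _ (∧-true-elimˡ _ _ e)) (sym (+-suc (q * 3) r)))
  where
  r<2 : r < 2
  r<2 = subst (_< 2) ([q*3+r]%3≡r q r r<3) (<ᵇ-true⇒< _ _ (∧-true-elimʳ ((q′ * 3 + s) ≡ᵇ suc (q * 3 + r)) _ e))
... | refl , s≡1+r = refl , s≡1+r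

path-step-intro : ∀ q r → suc r < 3 → path-step (q * 3 + r) (q * 3 + suc r) ≡ true
path-step-intro q r 1+r<3 = ∧-true-intro _ _ (≡⇒≡ᵇ-true _ _ (+-suc (q * 3) r))
  (<⇒<ᵇ-true _ _ (subst (_< 2) (sym ([q*3+r]%3≡r q r (<-trans (n<1+n r) 1+r<3))) (≤-pred 1+r<3)))

Consecutive : Fin 3 → Fin 3 → Set
Consecutive r s = toℕ s ≡ suc (toℕ r) ⊎ toℕ r ≡ suc (toℕ s)

module kP3Model (k : ℕ) where

  data View : Fin (k * 3) → Set where
    at : (q : Fin k) (r : Fin 3) → View (combine q r)

  view : ∀ i → View i
  view i = subst View (combine-remQuot {k} 3 i) (at (proj₁ (remQuot {k} 3 i)) (proj₂ (remQuot {k} 3 i)))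

  toℕ-combine3 : ∀ (q : Fin k) (r : Fin 3) → toℕ (combine q r) ≡ toℕ q * 3 + toℕ r
  toℕ-combine3 q r = trans (toℕ-combine q r) (cong (_+ toℕ r) (*-comm 3 (toℕ q)))

  adj⇒consecutive : ∀ q q′ r r′ → adj (kP3 k) (combine q r) (combine q′ r′) ≡ true → q ≡ q′ × Consecutive r r′
  adj⇒consecutive q q′ r r′ e
    with ∨-true-elim _ _ (∧-true-elimʳ (not (toℕ (combine q r) ≡ᵇ toℕ (combine q′ r′))) _ e)
  ... | inj₁ h with path-step⇒ (toℕ q) (toℕ q′) (toℕ r) (toℕ r′) (toℕ<n r) (toℕ<n r′)
                      (subst₂ (λ a b → path-step a b ≡ true) (toℕ-combine3 q r) (toℕ-combine3 q′ r′) h)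
  ...   | q≡q′ , r′≡1+r = toℕ-injective q≡q′ , inj₁ r′≡1+r
  adj⇒consecutive q q′ r r′ e | inj₂ h with path-step⇒ (toℕ q′) (toℕ q) (toℕ r′) (toℕ r) (toℕ<n r′) (toℕ<n r)
                      (subst₂ (λ a b → path-step a b ≡ true) (toℕ-combine3 q′ r′) (toℕ-combine3 q r) h)
  ...   | q′≡q , r≡1+r′ = sym (toℕ-injective q′≡q) , inj₂ r≡1+r′

  adj-suc : ∀ q r r′ → toℕ r′ ≡ suc (toℕ r) → adj (kP3 k) (combine q r) (combine q r′) ≡ true
  adj-suc q r r′ e = ∧-true-intro _ _ (not-false⇒true _ (≢⇒≡ᵇ-false _ _ r≢r′)) (∨-true-introˡ _ _ forward)
    where
    forward : path-step (toℕ (combine q r)) (toℕ (combine q r′)) ≡ true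
    forward = subst₂ (λ a b → path-step a b ≡ true) (sym (toℕ-combine3 q r))
      (trans (cong (toℕ q * 3 +_) (sym e)) (sym (toℕ-combine3 q r′)))
      (path-step-intro (toℕ q) (toℕ r) (subst (_< 3) e (toℕ<n r′)))
    r≢r′ : toℕ (combine q r) ≢ toℕ (combine q r′)
    r≢r′ c with divmod3-unique (toℕ q) (toℕ q) (toℕ r) (toℕ r′) (toℕ<n r) (toℕ<n r′)
                 (trans (sym (toℕ-combine3 q r)) (trans c (toℕ-combine3 q r′)))
    ... | _ , r≡r′ = 1+n≢n (sym (trans r≡r′ e))

  consecutive⇒adj : ∀ q r r′ → Consecutive r r′ → adj (kP3 k) (combine q r) (combine q r′) ≡ true
  consecutive⇒adj q r r′ (inj₁ e) = adj-suc q r r′ e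
  consecutive⇒adj q r r′ (inj₂ e) = trans (adj-symmetric (kP3 k) (combine q r) (combine q r′)) (adj-suc q r′ r e)

module kP3Embedding (k : ℕ) (G : Graph) (path : Fin k → Fin 3 → Vertex G)
  (edge₀₁ : ∀ a → Adj G (path a zero) (path a (suc zero)))
  (edge₁₂ : ∀ a → Adj G (path a (suc zero)) (path a (suc (suc zero))))
  (apart₀₂ : ∀ a → Apart G (path a zero) (path a (suc (suc zero))))
  (apart : ∀ {a b} → a ≢ b → ∀ s t → Apart G (path a s) (path b t)) where

  open kP3Model k using (View; view; at)
  module M = kP3Model k

  f : Fin (k * 3) → Vertex G
  f i = uncurry path (remQuot {k} 3 i)

  f-combine : ∀ q r → f (combine q r) ≡ path q r
  f-combine q r = cong (uncurry path) (remQuot-combine q r)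

  within : ∀ q r s → r ≢ s →
    (Apart G (path q r) (path q s) × ¬ Consecutive r s) ⊎ (Adj G (path q r) (path q s) × Consecutive r s)
  within q zero             zero             r≢s = ⊥-elim (r≢s refl)
  within q zero             (suc zero)       _   = inj₂ (edge₀₁ q , inj₁ refl)
  within q zero             (suc (suc zero)) _   = inj₁ (apart₀₂ q , λ { (inj₁ ()) ; (inj₂ ()) })
  within q (suc zero)       zero             _   = inj₂ (Adj-sym G (edge₀₁ q) , inj₂ refl)
  within q (suc zero)       (suc zero)       r≢s = ⊥-elim (r≢s refl)
  within q (suc zero)       (suc (suc zero)) _   = inj₂ (edge₁₂ q , inj₁ refl)
  within q (suc (suc zero)) zero             _   = inj₁ (apart-sym G (apart₀₂ q) , λ { (inj₁ ()) ; (inj₂ ()) })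
  within q (suc (suc zero)) (suc zero)       _   = inj₂ (Adj-sym G (edge₁₂ q) , inj₂ refl)
  within q (suc (suc zero)) (suc (suc zero)) r≢s = ⊥-elim (r≢s refl)

  distinct : ∀ {i j} → i ≢ j → f i ≢ f j
  distinct {i} {j} i≢j with view i | view j
  ... | at q r | at q′ r′ rewrite f-combine q r | f-combine q′ r′ with q ≟ q′
  ...   | no q≢q′ = proj₁ (apart q≢q′ r r′)
  ...   | yes refl with within q r r′ (λ { refl → i≢j refl })
  ...     | inj₁ ((r≢r′ , _) , _) = r≢r′
  ...     | inj₂ (e , _)          = Adj⇒≢ G e

  adjacency : ∀ {i j} → i ≢ j → adj (kP3 k) i j ≡ adj G (f i) (f j)
  adjacency {i} {j} i≢j with view i | view j
  ... | at q r | at q′ r′ rewrite f-combine q r | f-combine q′ r′ with q ≟ q′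
  ...   | no q≢q′ = trans (≢true⇒≡false (λ e → q≢q′ (proj₁ (M.adj⇒consecutive q q′ r r′ e))))
                          (sym (proj₂ (apart q≢q′ r r′)))
  ...   | yes refl with within q r r′ (λ { refl → i≢j refl })
  ...     | inj₁ ((_ , r≁r′) , ¬c) =
    trans (≢true⇒≡false (λ e → ¬c (proj₂ (M.adj⇒consecutive q q r r′ e)))) (sym r≁r′)
  ...     | inj₂ (e , c) = trans (M.consecutive⇒adj q r r′ c) (sym e)

  embedding : kP3 k ≺ G
  embedding = ≺-intro {kP3 k} {G} f distinct adjacency

-- The model graphs have many cut vertices

first-step : ∀ {G P a b} → WalkIn G P a b → a ≢ b → Σ (Vertex G) λ y → Adj G a y × P y
first-step (here _) a≢b = ⊥-elim (a≢b refl)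
first-step {a = a} (step {w = w} {v = v} p e pv) a≢b with a ≟ w
... | yes refl = v , e , pv
... | no  a≢w  = first-step p a≢w

pendant⇒separates : ∀ G {v a b} → Adj G v a → Adj G v b → (∀ {y} → Adj G a y → y ≡ v) → a ≢ b →
  Separates G v a b
pendant⇒separates G va vb only-v a≢b = va , vb , λ p → let (y , ay , y≢v) = first-step p a≢b in y≢v (only-v ay)

cuts⇒≤numSdeg≥2 : ∀ G {c} (g : Fin c → Vertex G) → (∀ {i j} → g i ≡ g j → i ≡ j) → (∀ i → IsCut G (g i)) →
  c ≤ numSdeg≥2 G
cuts⇒≤numSdeg≥2 G {c} g g-inj cut = subst (_≤ numSdeg≥2 G) (countF-true c)
  (countF-mono-injective (λ _ → true) (λ v → _) g (λ i _ → cut i) (λ i j _ _ e → g-inj e))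

-- In each model graph with c + 1 branches, the attachment vertex of each of the first c
-- pendant vertices separates it from a vertex of the last branch.

Kstar-cuts : ∀ c → c ≤ numSdeg≥2 (Kstar (suc c))
Kstar-cuts c = cuts⇒≤numSdeg≥2 X g (λ e → inject₁-injective (↑ˡ-injective k _ _ e)) cut
  where
  k : ℕ
  k = suc c
  X : Graph
  X = Kstar k
  open KstarModel k
  g : Fin c → Vertex X
  g i = inject₁ i ↑ˡ k
  only-core : ∀ a {y} → Adj X (k ↑ʳ a) y → y ≡ a ↑ˡ k
  only-core a {y} e with view y
  ... | at-core b    = cong (_↑ˡ k) (pendant-of⇒≡ b a
                         (trans (sym (core-pendant b a)) (trans (adj-symmetric X (b ↑ˡ k) (k ↑ʳ a)) e)))
  ... | at-pendant b = ⊥-elim (true≢false (trans (sym e) (pendant-pendant a b)))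
  pendant≢core : ∀ a b → k ↑ʳ a ≢ b ↑ˡ k
  pendant≢core a b e with trans (sym (splitAt-↑ʳ k k a)) (trans (cong (splitAt k) e) (splitAt-↑ˡ k b k))
  ... | ()
  cut : ∀ i → IsCut X (g i)
  cut i = separates⇒isCut X (g i) (pendant⇒separates X
    (trans (core-pendant (inject₁ i) (inject₁ i)) (pendant-of (inject₁ i)))
    (core-core (inject₁ i) (fromℕ c) (≢-sym fromℕ≢inject₁))
    (only-core (inject₁ i)) (pendant≢core _ _))

K1star-cuts : ∀ c → c ≤ numSdeg≥2 (K1star (suc c))
K1star-cuts c = cuts⇒≤numSdeg≥2 X g (λ e → inject₁-injective (↑ˡ-injective k _ _ (Fin-suc-injective e))) cut
  where
  k : ℕ
  k = suc c
  X : Graph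
  X = K1star k
  open K1starModel k
  g : Fin c → Vertex X
  g i = leaf (inject₁ i)
  only-leaf : ∀ a {y} → Adj X (pendant a) y → y ≡ leaf a
  only-leaf a {y} e with view y
  ... | at-hub       = ⊥-elim (true≢false (trans (sym e) (trans (adj-symmetric X (pendant a) zero) (hub-pendant a))))
  ... | at-leaf b    = cong leaf (KstarModel.pendant-of⇒≡ k b a
                         (trans (sym (leaf-pendant b a)) (trans (adj-symmetric X (leaf b) (pendant a)) e)))
  ... | at-pendant b = ⊥-elim (true≢false (trans (sym e) (pendant-pendant a b)))
  cut : ∀ i → IsCut X (g i)
  cut i = separates⇒isCut X (g i) (pendant⇒separates X {a = pendant (inject₁ i)} {b = zero}
    (trans (leaf-pendant (inject₁ i) (inject₁ i)) (KstarModel.pendant-of k (inject₁ i)))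
    (trans (adj-symmetric X (leaf (inject₁ i)) zero) (hub-leaf (inject₁ i)))
    (only-leaf (inject₁ i)) (λ ()))

kP3-cuts : ∀ c → c ≤ numSdeg≥2 (kP3 (suc c))
kP3-cuts c = cuts⇒≤numSdeg≥2 X g g-injective cut
  where
  k : ℕ
  k = suc c
  X : Graph
  X = kP3 k
  open kP3Model k
  g : Fin c → Vertex X
  g i = combine (inject₁ i) (suc zero)
  g-injective : ∀ {i j} → g i ≡ g j → i ≡ j
  g-injective {i} {j} e = inject₁-injective (cong proj₁ (trans (sym (remQuot-combine (inject₁ i) (suc zero)))
     (trans (cong (remQuot 3) e) (remQuot-combine (inject₁ j) (suc zero)))))
  only-middle : ∀ q {y} → Adj X (combine q zero) y → y ≡ combine q (suc zero)
  only-middle q {y} e with view y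
  ... | at q′ r′ with adj⇒consecutive q q′ zero r′ e
  ...   | refl , inj₁ r′≡1 = cong (combine q) (toℕ≡1 r′ r′≡1)
    where
    toℕ≡1 : ∀ (r : Fin 3) → toℕ r ≡ 1 → r ≡ suc zero
    toℕ≡1 (suc zero) refl = refl
  ...   | refl , inj₂ ()
  ends-distinct : ∀ q → combine {k} {3} q zero ≢ combine q (suc (suc zero))
  ends-distinct q e with cong proj₂ (trans (sym (remQuot-combine q zero))
                           (trans (cong (remQuot 3) e) (remQuot-combine q (suc (suc zero)))))
  ... | ()
  cut : ∀ i → IsCut X (g i)
  cut i = separates⇒isCut X (g i) (pendant⇒separates X
    (consecutive⇒adj q (suc zero) zero (inj₂ refl)) (consecutive⇒adj q (suc zero) (suc (suc zero)) (inj₁ refl))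
    (only-middle q) (ends-distinct q))
    where
    q : Fin k
    q = inject₁ i

-- Inner cut vertices and the tree order

module Tree (G : Graph) where

  -- Think of each component as rooted at its least vertex rep v: x lies below v when v
  -- separates x from the root.
  Below : Vertex G → Vertex G → Set
  Below v x = Conn G x v × x ≢ v × ¬ Avoiding G v x (rep G v)

  below? : ∀ v x → Dec (Below v x)
  below? v x = (connected G x v ≟ᵇ true) ×-dec (¬? (x ≟ v) ×-dec ¬? (avoiding? G v x (rep G v)))

  below-rep : ∀ {v x} → Below v x → rep G x ≡ rep G v
  below-rep (x~v , _) = rep-cong G x~v

  below⇒≢ : ∀ {v x} → Below v x → x ≢ v
  below⇒≢ (_ , x≢v , _) = x≢v

  ¬below⇒avoiding : ∀ {v x} → Conn G x v → x ≢ v → ¬ Below v x → Avoiding G v x (rep G v)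
  ¬below⇒avoiding {v} {x} x~v x≢v ¬below =
    decidable-stable (avoiding? G v x (rep G v)) (λ ¬avoid → ¬below (x~v , x≢v , ¬avoid))

  rep≢below : ∀ {v x} → Below v x → rep G v ≢ x
  rep≢below (_ , x≢v , ¬avoid) e = ¬avoid (subst (Avoiding G _ _) (sym e) (here x≢v))

  below-step : ∀ {v x y} → Below v x → Adj G x y → y ≢ v → Below v y
  below-step (x~v , x≢v , ¬avoid) xy y≢v =
    conn-trans G (adj⇒conn G (Adj-sym G xy)) x~v , y≢v , λ p → ¬avoid (walk-++ (walk-edge x≢v xy y≢v) p)

  Outside : Vertex G → Vertex G → Set
  Outside v y = ¬ Below v y × y ≢ v

  below-boundary : ∀ {v x y} → Below v x → Outside v y → Apart G x y
  below-boundary {v} bx (¬by , y≢v) =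
    (λ e → ¬by (subst (Below v) e bx)) , ≢true⇒≡false (λ xy → ¬by (below-step bx xy y≢v))

  -- Follow a walk from the common root to a until it first hits a or b.
  below-antisym : ∀ {a b} → Below b a → Below a b → ⊥
  below-antisym {a} {b} ba ab with first-exit (λ t → ¬? (t ≟ a) ×-dec ¬? (t ≟ b)) (conn⇒walk G rb~a) (rep≢below ba , rb≢b)
    where
    rb~a : Conn G (rep G b) a
    rb~a = conn-sym G (conn-trans G (proj₁ ba) (conn-sym G (rep-conn G b)))
    rb≢b : rep G b ≢ b
    rb≢b e = rep≢below ab (trans (sym (below-rep ab)) e)
  ... | inj₁ p = proj₁ (proj₁ (walk-end p)) refl
  ... | inj₂ (x , y , p , xy , ¬y∉ab , _) with y ≟ a | y ≟ b
  ...   | yes refl | _ = proj₂ (proj₂ ba) (walk-reverse (step (walk-map (λ q → proj₂ (proj₁ q)) p) xy (below⇒≢ ba)))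
  ...   | no _ | yes refl = proj₂ (proj₂ ab) (subst (Avoiding G a b) (below-rep ab)
                              (walk-reverse (step (walk-map (λ q → proj₁ (proj₁ q)) p) xy (below⇒≢ ab))))
  ...   | no y≢a | no y≢b = ¬y∉ab (y≢a , y≢b)

  below-trans : ∀ {a b x} → Below b a → Below a x → Below b x
  below-trans {a} {b} {x} ba ax = conn-trans G (proj₁ ax) (proj₁ ba) , x≢b , ¬avoid
    where
    x≢b : x ≢ b
    x≢b refl = below-antisym ba ax
    ¬avoid : ¬ Avoiding G b x (rep G b)
    ¬avoid p with first-exit (λ t → ¬? (t ≟ a)) (walk-reverse p) (rep≢below ba)
    ... | inj₁ q = proj₂ (proj₂ ax) (walk-reverse (subst (λ t → Avoiding G a t x) (sym (below-rep ba))
                     (walk-map proj₁ q)))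
    ... | inj₂ (y , z , q , yz , ¬z≢a , _) with decidable-stable (z ≟ a) ¬z≢a
    ...   | refl = proj₂ (proj₂ ba) (walk-reverse (step (walk-map proj₂ q) yz (below⇒≢ ba)))

  -- If neither is below the other, follow a walk from x to the root until it first hits u or w.
  below-linear : ∀ {u w x} → Below u x → Below w x → u ≢ w → Below u w ⊎ Below w u
  below-linear {u} {w} {x} ux wx u≢w with below? u w | below? w u
  ... | yes uw | _ = inj₁ uw
  ... | no _ | yes wu = inj₂ wu
  ... | no ¬uw | no ¬wu
    with first-exit (λ t → ¬? (t ≟ u) ×-dec ¬? (t ≟ w)) (conn⇒walk G x~ru) (below⇒≢ ux , below⇒≢ wx)
    where
    x~ru : Conn G x (rep G u)
    x~ru = conn-trans G (proj₁ ux) (conn-sym G (rep-conn G u))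
  ...   | inj₁ p = ⊥-elim (proj₂ (proj₂ ux) (walk-map (λ q → proj₁ (proj₁ q)) p))
  ...   | inj₂ (y , z , p , yz , ¬z∉uw , _) with z ≟ u | z ≟ w
  ...     | yes refl | _ = ⊥-elim (proj₂ (proj₂ wx) (walk-++ (step (walk-map (λ q → proj₂ (proj₁ q)) p) yz u≢w)
              (¬below⇒avoiding (conn-trans G (conn-sym G (proj₁ ux)) (proj₁ wx)) u≢w ¬wu)))
  ...     | no _ | yes refl = ⊥-elim (proj₂ (proj₂ ux)
              (walk-++ (step (walk-map (λ q → proj₁ (proj₁ q)) p) yz (≢-sym u≢w))
              (¬below⇒avoiding (conn-trans G (conn-sym G (proj₁ wx)) (proj₁ ux)) (≢-sym u≢w) ¬uw)))
  ...     | no z≢u | no z≢w = ⊥-elim (¬z∉uw (z≢u , z≢w))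

  -- Of two neighbours separated by a cut vertex, at most one reaches the root avoiding it.
  cut⇒child : ∀ {v} → IsCut G v → Σ (Vertex G) λ p → Adj G v p × Below v p
  cut⇒child {v} cut with isCut⇒separates G v cut
  ... | a , b , va , vb , a↮b with below? v a | below? v b
  ...   | yes below-a | _ = a , va , below-a
  ...   | no _ | yes below-b = b , vb , below-b
  ...   | no ¬below-a | no ¬below-b = ⊥-elim (a↮b (walk-++
          (¬below⇒avoiding (adj⇒conn G (Adj-sym G va)) (Adj⇒≢ G (Adj-sym G va)) ¬below-a)
          (walk-reverse (¬below⇒avoiding (adj⇒conn G (Adj-sym G vb)) (Adj⇒≢ G (Adj-sym G vb)) ¬below-b))))

  non-root⇒parent : ∀ {v} → rep G v ≢ v → Σ (Vertex G) λ w → Adj G v w × Avoiding G v w (rep G v)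
  non-root⇒parent {v} r≢v with first-exit (λ t → ¬? (t ≟ v)) (conn⇒walk G (rep-conn G v)) r≢v
  ... | inj₁ p = ⊥-elim (proj₁ (walk-end p) refl)
  ... | inj₂ (a , b , p , ab , ¬b≢v , _) with decidable-stable (b ≟ v) ¬b≢v
  ...   | refl = a , Adj-sym G ab , walk-reverse (walk-map proj₁ p)

  record InnerCut : Set where
    field
      vertex       : Vertex G
      child        : Vertex G
      parent       : Vertex G
      child-adj    : Adj G vertex child
      child-below  : Below vertex child
      parent-adj   : Adj G vertex parent
      parent-above : Avoiding G vertex parent (rep G vertex)

    parent-outside : Outside vertex parent
    parent-outside = (λ { (_ , _ , ¬avoid) → ¬avoid parent-above }) , ≢-sym (Adj⇒≢ G parent-adj)

    child-parent-apart : Apart G child parent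
    child-parent-apart = below-boundary child-below parent-outside

  innerCut : ∀ {v} → IsCut G v → rep G v ≢ v → InnerCut
  innerCut {v} cut r≢v with cut⇒child cut | non-root⇒parent r≢v
  ... | p , vp , below | w , vw , above = record
    { vertex = v ; child = p ; parent = w
    ; child-adj = vp ; child-below = below ; parent-adj = vw ; parent-above = above }

module _ (G : Graph) where
  open Tree G
  open InnerCut

  innerPath : InnerCut → Fin 3 → Vertex G
  innerPath c zero             = child c
  innerPath c (suc zero)       = vertex c
  innerPath c (suc (suc zero)) = parent c

  innerPaths-apart : ∀ {k} (c : Fin k → InnerCut) →
    (∀ {a b} → a ≢ b → ∀ s t → Apart G (innerPath (c a) s) (innerPath (c b) t)) → kP3 k ≺ G
  innerPaths-apart {k} c apart = kP3Embedding.embedding k G (λ a → innerPath (c a))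
    (λ a → Adj-sym G (child-adj (c a))) (λ a → parent-adj (c a)) (λ a → child-parent-apart (c a)) apart

  -- The paths at c (4 t) are pairwise apart: the t-th lies below c (4 t + 2), the later
  -- ones outside it.
  module Chain (k : ℕ) (c : ℕ → InnerCut)
    (ordered : ∀ {i j} → i < j → j < k * 4 → Below (vertex (c j)) (vertex (c i))) where

    V : ℕ → Vertex G
    V i = vertex (c i)

    module _ {t t′} (t<t′ : t < t′) (t′<k : t′ < k) where
      private
        i m j : ℕ
        i = t * 4
        m = 2 + t * 4
        j = t′ * 4
        j<L : j < k * 4
        j<L = ≤-trans (s≤s (m≤n+m j 3)) (*-monoˡ-≤ 4 t′<k)
        1+m<j : 1 + m < j
        1+m<j = *-monoˡ-≤ 4 t<t′
        m<j : m < j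
        m<j = <-trans (n<1+n m) 1+m<j
        below : ∀ {x y} → x < y → y < j → Below (V y) (V x)
        below x<y y<j = ordered x<y (<-trans y<j j<L)
        below-j : ∀ {x} → x < j → Below (V j) (V x)
        below-j x<j = ordered x<j j<L
        1+i<m : 1 + i < m
        1+i<m = n<1+n (1 + i)
        i<m : i < m
        i<m = <-trans (n<1+n i) 1+i<m

      inside : ∀ s → Below (V m) (innerPath (c i) s)
      inside zero             = below-trans (below i<m m<j) (child-below (c i))
      inside (suc zero)       = below i<m m<j
      inside (suc (suc zero)) with parent (c i) ≟ V (1 + i)
      ... | yes e   = subst (Below (V m)) (sym e) (below 1+i<m m<j)
      ... | no p≢v′ = below-trans (below 1+i<m m<j)
                        (below-step (below (n<1+n i) (<-trans 1+i<m m<j)) (parent-adj (c i)) p≢v′)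

      outside : ∀ s → Outside (V m) (innerPath (c j) s)
      outside (suc zero) = below-antisym (below-j m<j) , ≢-sym (below⇒≢ (below-j m<j))
      outside (suc (suc zero)) =
        (λ b → proj₁ (parent-outside (c j)) (below-trans (below-j m<j) b)) ,
        (λ e → proj₁ (parent-outside (c j)) (subst (Below (V j)) (sym e) (below-j m<j)))
      outside zero =
        (λ b → proj₁ (outside (suc zero)) (below-step b (Adj-sym G (child-adj (c j))) (proj₂ (outside (suc zero))))) ,
        (λ e → below-antisym (below-j 1+m<j)
          (below-step (below (n<1+n m) 1+m<j) (subst (λ x → Adj G x (V j)) e (Adj-sym G (child-adj (c j))))
                      (≢-sym (below⇒≢ (below-j 1+m<j)))))

      apart-< : ∀ s s′ → Apart G (innerPath (c i) s) (innerPath (c j) s′)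
      apart-< s s′ = below-boundary (inside s) (outside s′)

    embedding : kP3 k ≺ G
    embedding = innerPaths-apart (λ a → c (toℕ a * 4)) apart
      where
      apart : ∀ {a b : Fin k} → a ≢ b → ∀ s t → Apart G (innerPath (c (toℕ a * 4)) s) (innerPath (c (toℕ b * 4)) t)
      apart {a} {b} a≢b s t with <-cmp (toℕ a) (toℕ b)
      ... | tri< a<b _ _ = apart-< a<b (toℕ<n b) s t
      ... | tri≈ _ a≡b _ = ⊥-elim (a≢b (toℕ-injective a≡b))
      ... | tri> _ _ b<a = apart-sym G (apart-< b<a (toℕ<n a) t s)

  module Antichain {k} (c : Fin k → InnerCut)
    (distinct : ∀ {a b} → a ≢ b → vertex (c a) ≢ vertex (c b))
    (incomparable : ∀ {a b} → a ≢ b → ¬ Below (vertex (c a)) (vertex (c b))) where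

    V : Fin k → Vertex G
    V a = vertex (c a)

    vertex-outside : ∀ {a b} → a ≢ b → Outside (V a) (V b)
    vertex-outside a≢b = incomparable a≢b , distinct (≢-sym a≢b)

    below-disjoint : ∀ {a b x} → a ≢ b → Below (V a) x → ¬ Below (V b) x
    below-disjoint a≢b ax bx with below-linear ax bx (distinct a≢b)
    ... | inj₁ ab = incomparable a≢b ab
    ... | inj₂ ba = incomparable (≢-sym a≢b) ba

    child-outside : ∀ {a b} → a ≢ b → Outside (V a) (child (c b))
    child-outside {a} {b} a≢b = below-disjoint (≢-sym a≢b) (child-below (c b)) ,
      λ e → incomparable (≢-sym a≢b) (subst (Below (V b)) e (child-below (c b)))

    child-apart : ∀ a {y} → Outside (V a) y → Apart G (child (c a)) y
    child-apart a = below-boundary (child-below (c a))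

    vertex-child-apart : ∀ {a b} → a ≢ b → Apart G (V a) (child (c b))
    vertex-child-apart {a} {b} a≢b = apart-sym G (child-apart b (vertex-outside (≢-sym a≢b)))

    child-child-apart : ∀ {a b} → a ≢ b → Apart G (child (c a)) (child (c b))
    child-child-apart {a} a≢b = child-apart a (child-outside a≢b)

    clique⇒Kstar : (∀ {a b} → a ≢ b → Adj G (V a) (V b)) → Kstar k ≺ G
    clique⇒Kstar clique = KstarEmbedding.embedding k G V (λ a → child (c a)) clique
      (λ a → child-adj (c a)) vertex-child-apart child-child-apart

    module Independent (independent : ∀ {a b} → a ≢ b → Apart G (V a) (V b)) where

      parent-outside′ : ∀ a b → Outside (V a) (parent (c b))
      parent-outside′ a b with a ≟ b
      ... | yes refl = parent-outside (c a)
      ... | no a≢b = (λ below → incomparable a≢b (below-step below (Adj-sym G (parent-adj (c b))) (distinct (≢-sym a≢b)))) ,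
                     (λ e → true≢false (trans (sym (subst (Adj G (V b)) e (parent-adj (c b))))
                                              (proj₂ (independent (≢-sym a≢b)))))

      star⇒K1star : (hub : Vertex G) → (∀ a → Adj G hub (V a)) → (∀ a → Outside (V a) hub) → K1star k ≺ G
      star⇒K1star hub hub-adj hub-outside = K1starEmbedding.embedding k G hub V (λ a → child (c a)) hub-adj
        (λ a → apart-sym G (child-apart a (hub-outside a))) independent (λ a → child-adj (c a))
        vertex-child-apart child-child-apart

      module ParentsAway (parent-vertex : ∀ {a b} → a ≢ b → adj G (parent (c a)) (V b) ≡ false) where

        parent-vertex-apart : ∀ {a b} → a ≢ b → Apart G (parent (c a)) (V b)
        parent-vertex-apart {a} {b} a≢b = proj₂ (parent-outside′ b a) , parent-vertex a≢b

        parents-clique⇒Kstar : (∀ {a b} → a ≢ b → Adj G (parent (c a)) (parent (c b))) → Kstar k ≺ G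
        parents-clique⇒Kstar clique = KstarEmbedding.embedding k G (λ a → parent (c a)) V clique
          (λ a → Adj-sym G (parent-adj (c a))) parent-vertex-apart independent

        parents-independent⇒kP3 : (∀ {a b} → a ≢ b → adj G (parent (c a)) (parent (c b)) ≡ false) → kP3 k ≺ G
        parents-independent⇒kP3 parents-independent = innerPaths-apart c apart
          where
          outside : ∀ {a b} → a ≢ b → ∀ t → Outside (V a) (innerPath (c b) t)
          outside a≢b zero             = child-outside a≢b
          outside a≢b (suc zero)       = vertex-outside a≢b
          outside {a} {b} a≢b (suc (suc zero)) = parent-outside′ a b
          apart : ∀ {a b} → a ≢ b → ∀ s t → Apart G (innerPath (c a) s) (innerPath (c b) t)
          apart {a} a≢b zero                   t                = child-apart a (outside a≢b t)
          apart a≢b (suc zero)       zero             = vertex-child-apart a≢b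
          apart a≢b (suc zero)       (suc zero)       = independent a≢b
          apart a≢b (suc zero)       (suc (suc zero)) = apart-sym G (parent-vertex-apart (≢-sym a≢b))
          apart {a} {b} a≢b (suc (suc zero)) zero     = apart-sym G (child-apart b (parent-outside′ b a))
          apart a≢b (suc (suc zero)) (suc zero)       = parent-vertex-apart a≢b
          apart {a} {b} a≢b (suc (suc zero)) (suc (suc zero)) =
            (λ e → true≢false (trans (sym (subst (λ x → Adj G x (V b)) (sym e) (Adj-sym G (parent-adj (c b)))))
                                     (parent-vertex a≢b))) ,
            parents-independent a≢b

-- Many cut vertices force a model graph

ordered⇒distinct : ∀ {m} {A : Set} (R : A → A → Set) (g : Fin m → A) →
  (∀ {a b} → toℕ a < toℕ b → R (g a) (g b)) → (∀ {a b} → toℕ a < toℕ b → R (g b) (g a)) →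
  ∀ {a b} → a ≢ b → R (g a) (g b)
ordered⇒distinct R g forward backward {a} {b} a≢b with <-cmp (toℕ a) (toℕ b)
... | tri< a<b _ _ = forward a<b
... | tri≈ _ a≡b _ = ⊥-elim (a≢b (toℕ-injective a≡b))
... | tri> _ _ b<a = backward b<a

HasModel : Graph → ℕ → Set
HasModel G k = Kstar k ≺ G ⊎ kP3 k ≺ G ⊎ K1star k ≺ G

separate-components⇒kP3 : ∀ G {k} (f : Fin k → Vertex G) → (∀ a → IsCut G (f a)) →
  (∀ {a b} → a ≢ b → ¬ Conn G (f a) (f b)) → kP3 k ≺ G
separate-components⇒kP3 G {k} f cut apart-components = kP3Embedding.embedding k G triple
  (λ a → Adj-sym G (za a)) zb (λ a → separates⇒apart G (separates a)) cross-apart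
  where
  sep : ∀ a → Σ (Vertex G) λ x → Σ (Vertex G) λ y → Separates G (f a) x y
  sep a = isCut⇒separates G (f a) (cut a)
  end₀ end₂ : Fin k → Vertex G
  end₀ a = proj₁ (sep a)
  end₂ a = proj₁ (proj₂ (sep a))
  separates : ∀ a → Separates G (f a) (end₀ a) (end₂ a)
  separates a = proj₂ (proj₂ (sep a))
  za : ∀ a → Adj G (f a) (end₀ a)
  za a = proj₁ (separates a)
  zb : ∀ a → Adj G (f a) (end₂ a)
  zb a = proj₁ (proj₂ (separates a))
  triple : Fin k → Fin 3 → Vertex G
  triple a zero             = end₀ a
  triple a (suc zero)       = f a
  triple a (suc (suc zero)) = end₂ a
  in-component : ∀ a s → Conn G (triple a s) (f a)
  in-component a zero             = adj⇒conn G (Adj-sym G (za a))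
  in-component a (suc zero)       = conn-refl G (f a)
  in-component a (suc (suc zero)) = adj⇒conn G (Adj-sym G (zb a))
  cross-apart : ∀ {a b} → a ≢ b → ∀ s t → Apart G (triple a s) (triple b t)
  cross-apart {a} {b} a≢b s t =
    (λ e → apart-components a≢b (conn-trans G (conn-sym G (in-component a s))
             (subst (λ x → Conn G x (f b)) (sym e) (in-component b t)))) ,
    ≢true⇒≡false (λ e → apart-components a≢b (conn-trans G (conn-sym G (in-component a s))
             (conn-trans G (adj⇒conn G e) (in-component b t))))

-- bound₀ suffices for the cascade of six Ramsey steps below, bound₁ for the last five, and so on.
module Bounds (k′ : ℕ) where
  k L : ℕ
  k = suc k′
  L = k * 4

  bound₀ bound₁ bound₂ bound₃ bound₄ bound₅ : ℕ
  bound₅ = ramseyBound k k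
  bound₄ = ramseyBound k bound₅
  bound₃ = ramseyBound k bound₄
  bound₂ = ramseyBound k bound₃
  bound₁ = ramseyBound L bound₂
  bound₀ = ramseyBound L bound₁

module InnerCuts (G : Graph) (k′ : ℕ) where
  open Tree G
  open InnerCut
  open Bounds k′

  record IsAntichain (ys : List InnerCut) : Set where
    field
      distinct  : AllPairs (λ x y → vertex x ≢ vertex y) ys
      not-above : AllPairs (λ x y → ¬ Below (vertex y) (vertex x)) ys
      not-below : AllPairs (λ x y → ¬ Below (vertex x) (vertex y)) ys

  isAntichain-⊆ : ∀ {xs ys} → xs ⊆ ys → IsAntichain ys → IsAntichain xs
  isAntichain-⊆ xs⊆ys anti = record
    { distinct  = AllPairs-resp-⊆ xs⊆ys (IsAntichain.distinct anti)
    ; not-above = AllPairs-resp-⊆ xs⊆ys (IsAntichain.not-above anti)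
    ; not-below = AllPairs-resp-⊆ xs⊆ys (IsAntichain.not-below anti) }

  module _ (d : InnerCut) where

    module AsFamily (zs : List InnerCut) (len : length zs ≡ k) (anti : IsAntichain zs) where
      member : Fin k → InnerCut
      member a = nth d zs (toℕ a)

      ordered : ∀ {R : InnerCut → InnerCut → Set} → AllPairs R zs → ∀ {a b} → toℕ a < toℕ b → R (member a) (member b)
      ordered rs {b = b} a<b = AllPairs-nth rs a<b (subst (toℕ b <_) (sym len) (toℕ<n b))

      both-ways : ∀ {R : InnerCut → InnerCut → Set} → AllPairs R zs → AllPairs (λ x y → R y x) zs →
        ∀ {a b} → a ≢ b → R (member a) (member b)
      both-ways {R} forward backward = ordered⇒distinct R member (ordered forward) (ordered backward)

      symmetric : ∀ {R : InnerCut → InnerCut → Set} → AllPairs R zs → (∀ {x y} → R x y → R y x) →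
        ∀ {a b} → a ≢ b → R (member a) (member b)
      symmetric {R} rs R-sym = ordered⇒distinct R member (ordered rs) (λ a<b → R-sym (ordered rs a<b))

      open Antichain G member
        (symmetric (IsAntichain.distinct anti) ≢-sym)
        (both-ways (IsAntichain.not-below anti) (IsAntichain.not-above anti))
        public

      apart-from : AllPairs (λ x y → ¬ Adj G (vertex x) (vertex y)) zs → ∀ {a b} → a ≢ b → Apart G (V a) (V b)
      apart-from ind a≢b = proj₂ (vertex-outside (≢-sym a≢b)) ,
                           ≢true⇒≡false (symmetric ind (λ ¬xy yx → ¬xy (Adj-sym G yx)) a≢b)

    module Refined {ys zs} (zs⊆ys : zs ⊆ ys) (len : length zs ≡ k) (anti : IsAntichain ys)
      (ind : AllPairs (λ x y → ¬ Adj G (vertex x) (vertex y)) ys) where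
      open AsFamily zs len (isAntichain-⊆ zs⊆ys anti) public
      open Independent (apart-from (AllPairs-resp-⊆ zs⊆ys ind)) public

    module RefinedAway {ys zs} (zs⊆ys : zs ⊆ ys) (len : length zs ≡ k) (anti : IsAntichain ys)
      (ind : AllPairs (λ x y → ¬ Adj G (vertex x) (vertex y)) ys)
      (pv : AllPairs (λ x y → ¬ Adj G (parent x) (vertex y)) ys)
      (vp : AllPairs (λ x y → ¬ Adj G (parent y) (vertex x)) ys) where
      open Refined zs⊆ys len anti ind public
      open ParentsAway (λ a≢b → ≢true⇒≡false (both-ways (AllPairs-resp-⊆ zs⊆ys pv) (AllPairs-resp-⊆ zs⊆ys vp) a≢b))
        public

    decide-parents : ∀ ys → bound₅ ≤ length ys → IsAntichain ys →
      AllPairs (λ x y → ¬ Adj G (vertex x) (vertex y)) ys →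
      AllPairs (λ x y → ¬ Adj G (parent x) (vertex y)) ys →
      AllPairs (λ x y → ¬ Adj G (parent y) (vertex x)) ys → HasModel G k
    decide-parents ys h anti ind pv vp with ramsey (λ x y → adj G (parent x) (parent y) ≟ᵇ true) k k ys h
    ... | inj₁ (zs , zs⊆ , len , clique) = inj₁ (parents-clique⇒Kstar (symmetric clique (Adj-sym G)))
      where
      open RefinedAway zs⊆ len anti ind pv vp
    ... | inj₂ (zs , zs⊆ , len , independent) =
      inj₂ (inj₁ (parents-independent⇒kP3 (λ a≢b →
        ≢true⇒≡false (symmetric independent (λ ¬xy yx → ¬xy (Adj-sym G yx)) a≢b))))
      where
      open RefinedAway zs⊆ len anti ind pv vp

    decide-earlier-parent : ∀ ys → bound₄ ≤ length ys → IsAntichain ys →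
      AllPairs (λ x y → ¬ Adj G (vertex x) (vertex y)) ys →
      AllPairs (λ x y → ¬ Adj G (parent x) (vertex y)) ys → HasModel G k
    decide-earlier-parent ys h anti ind pv with ramsey (λ x y → adj G (parent y) (vertex x) ≟ᵇ true) k bound₅ ys h
    ... | inj₁ (zs , zs⊆ , len , star) = inj₂ (inj₂ (star⇒K1star (parent (member last)) hub-adj
                                            (λ a → parent-outside′ a last)))
      where
      open Refined zs⊆ len anti ind
      last : Fin k
      last = fromℕ k′
      hub-adj : ∀ a → Adj G (parent (member last)) (V a)
      hub-adj a with a ≟ last
      ... | yes refl = Adj-sym G (parent-adj (member last))
      ... | no a≢last = ordered star (subst (toℕ a <_) (sym (toℕ-fromℕ k′))
                          (≤∧≢⇒< (≤-pred (toℕ<n a)) (λ e → a≢last (toℕ-injective (trans e (sym (toℕ-fromℕ k′)))))))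
    ... | inj₂ (zs , zs⊆ , len , vp) = decide-parents zs (≤-reflexive (sym len)) (isAntichain-⊆ zs⊆ anti)
                                         (AllPairs-resp-⊆ zs⊆ ind) (AllPairs-resp-⊆ zs⊆ pv) vp

    decide-later-parent : ∀ ys → bound₃ ≤ length ys → IsAntichain ys →
      AllPairs (λ x y → ¬ Adj G (vertex x) (vertex y)) ys → HasModel G k
    decide-later-parent ys h anti ind with ramsey (λ x y → adj G (parent x) (vertex y) ≟ᵇ true) k bound₄ ys h
    ... | inj₁ (zs , zs⊆ , len , star) = inj₂ (inj₂ (star⇒K1star (parent (member zero)) hub-adj
                                            (λ a → parent-outside′ a zero)))
      where
      open Refined zs⊆ len anti ind
      hub-adj : ∀ a → Adj G (parent (member zero)) (V a)
      hub-adj zero    = Adj-sym G (parent-adj (member zero))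
      hub-adj (suc a) = ordered star (s≤s z≤n)
    ... | inj₂ (zs , zs⊆ , len , pv) = decide-earlier-parent zs (≤-reflexive (sym len)) (isAntichain-⊆ zs⊆ anti)
                                         (AllPairs-resp-⊆ zs⊆ ind) pv

    decide-adjacent : ∀ ys → bound₂ ≤ length ys → IsAntichain ys → HasModel G k
    decide-adjacent ys h anti with ramsey (λ x y → adj G (vertex x) (vertex y) ≟ᵇ true) k bound₃ ys h
    ... | inj₁ (zs , zs⊆ , len , clique) = inj₁ (clique⇒Kstar (symmetric clique (Adj-sym G)))
      where open AsFamily zs len (isAntichain-⊆ zs⊆ anti)
    ... | inj₂ (zs , zs⊆ , len , ind) = decide-later-parent zs (≤-reflexive (sym len)) (isAntichain-⊆ zs⊆ anti) ind

    decide-below : ∀ ys → bound₁ ≤ length ys → AllPairs (λ x y → vertex x ≢ vertex y) ys →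
      AllPairs (λ x y → ¬ Below (vertex y) (vertex x)) ys → HasModel G k
    decide-below ys h distinct not-above with ramsey (λ x y → below? (vertex x) (vertex y)) L bound₂ ys h
    ... | inj₁ (zs , zs⊆ , len , descending) = inj₂ (inj₁ (Chain.embedding G k (λ i → nth d zs (L ∸ suc i)) ordered))
      where
      L-1-_<L : ∀ {i} → i < L → L ∸ suc i < L
      L-1-_<L i<L = ∸-monoʳ-< (s≤s z≤n) i<L
      ordered : ∀ {i j} → i < j → j < L → Below (vertex (nth d zs (L ∸ suc j))) (vertex (nth d zs (L ∸ suc i)))
      ordered i<j j<L = AllPairs-nth descending (∸-monoʳ-< (s≤s i<j) j<L)
                          (subst (_ <_) (sym len) (L-1-_<L (<-trans i<j j<L)))
    ... | inj₂ (zs , zs⊆ , len , not-below) =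
      decide-adjacent zs (≤-reflexive (sym len)) (record
        { distinct = AllPairs-resp-⊆ zs⊆ distinct ; not-above = AllPairs-resp-⊆ zs⊆ not-above ; not-below = not-below })

    decide-above : ∀ ys → bound₀ ≤ length ys → AllPairs (λ x y → vertex x ≢ vertex y) ys → HasModel G k
    decide-above ys h distinct with ramsey (λ x y → below? (vertex y) (vertex x)) L bound₁ ys h
    ... | inj₁ (zs , zs⊆ , len , ascending) = inj₂ (inj₁ (Chain.embedding G k (nth d zs)
                                                 (λ i<j j<L → AllPairs-nth ascending i<j (subst (_ <_) (sym len) j<L))))
    ... | inj₂ (zs , zs⊆ , len , not-above) =
      decide-below zs (≤-reflexive (sym len)) (AllPairs-resp-⊆ zs⊆ distinct) not-above

  many-inner-cuts⇒model : ∀ ys → bound₀ ≤ length ys → AllPairs (λ x y → vertex x ≢ vertex y) ys → HasModel G k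
  many-inner-cuts⇒model []       ()
  many-inner-cuts⇒model (d ∷ ys) = decide-above d (d ∷ ys)

root-cuts⇒kP3 : ∀ G k → k ≤ countF (λ v → isCut? G v ∧ isRep G v) → kP3 k ≺ G
root-cuts⇒kP3 G k many with pick _ k many
... | f , root-cut , f-injective = separate-components⇒kP3 G f (λ a → ∧-true-elimˡ _ _ (root-cut a))
  (λ {a} {b} a≢b a~b → a≢b (f-injective a b
    (isRep-conn⇒≡ G (∧-true-elimʳ _ _ (root-cut a)) (∧-true-elimʳ _ _ (root-cut b)) a~b)))

inner-cuts : ∀ G → let open Tree G in
  Σ (List InnerCut) λ xs → countF (λ v → isCut? G v ∧ not (isRep G v)) ≤ length xs ×
                           AllPairs (λ x y → InnerCut.vertex x ≢ InnerCut.vertex y) xs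
inner-cuts G = tabulate inner , ≤-reflexive (sym (length-tabulate inner)) ,
               AllPairs.tabulate⁺ (λ i≢j e → i≢j (enum-injective p _ _ e))
  where
  open Tree G
  p : Vertex G → Bool
  p v = isCut? G v ∧ not (isRep G v)
  inner : Fin (countF p) → InnerCut
  inner i = innerCut (∧-true-elimˡ _ _ (enum-sound p i)) λ e →
    true≢false (trans (sym (subst (λ v → isRep G v ≡ true) e (rep-isRep G v)))
                      (not-true⇒false _ (∧-true-elimʳ (isCut? G v) _ (enum-sound p i))))
    where
    v : Vertex G
    v = enum p i

cutBound : ℕ → ℕ
cutBound k′ = suc k′ + Bounds.bound₀ k′

many-cuts⇒model : ∀ G k′ → cutBound k′ ≤ numSdeg≥2 G → HasModel G (suc k′)
many-cuts⇒model G k′ many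
  with ≤-+-split (suc k′) (Bounds.bound₀ k′) (subst (cutBound k′ ≤_) (countF-split (isCut? G) (isRep G)) many)
... | inj₁ roots = inj₂ (inj₁ (root-cuts⇒kP3 G (suc k′) roots))
... | inj₂ inner with inner-cuts G
...   | xs , enough , distinct = InnerCuts.many-inner-cuts⇒model G k′ xs (≤-trans inner enough) distinct

Models : ℕ → Family
Models k = Triple (Kstar k) (kP3 k) (K1star k)

models-have-many-cuts : ∀ C {M} → Models (suc C) M → C ≤ numSdeg≥2 M
models-have-many-cuts C (inj₁ refl)        = Kstar-cuts C
models-have-many-cuts C (inj₂ (inj₁ refl)) = kP3-cuts C
models-have-many-cuts C (inj₂ (inj₂ refl)) = K1star-cuts C

free⇒no-model : ∀ {ℋ k G} → ℋ ≤F Models k → Free ℋ G → ¬ HasModel G k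
free⇒no-model {ℋ} {k} {G} ℋ≤models free = λ
  { (inj₁ M≺G)        → excluded (inj₁ refl) M≺G
  ; (inj₂ (inj₁ M≺G)) → excluded (inj₂ (inj₁ refl)) M≺G
  ; (inj₂ (inj₂ M≺G)) → excluded (inj₂ (inj₂ refl)) M≺G }
  where
  excluded : ∀ {M} → Models k M → ¬ (M ≺ G)
  excluded {M} model M≺G with ℋ≤models M model
  ... | H , H∈ℋ , H≺M = free H H∈ℋ (≺-trans {H} {M} {G} H≺M M≺G)

bounded⇒≤F-models : ExcludedMiddle 0ℓ → ∀ ℋ C → (∀ G → Free ℋ G → numSdeg≥2 G < C) → ℋ ≤F Models (suc C)
bounded⇒≤F-models em ℋ C bounded M model with em {Σ Graph λ H → ℋ H × (H ≺ M)}
... | yes below = below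
... | no ¬below = ⊥-elim (<⇒≱ (bounded M (λ H H∈ℋ H≺M → ¬below (H , H∈ℋ , H≺M))) (models-have-many-cuts C model))

≤F-models⇒bounded : ∀ ℋ k′ → ℋ ≤F Models (suc k′) → ∀ G → Free ℋ G → numSdeg≥2 G < cutBound k′
≤F-models⇒bounded ℋ k′ ℋ≤models G free with numSdeg≥2 G <? cutBound k′
... | yes few = few
... | no ¬few = ⊥-elim (free⇒no-model {ℋ} {suc k′} {G} ℋ≤models free (many-cuts⇒model G k′ (≮⇒≥ ¬few)))

corollary1p13 : ExcludedMiddle 0ℓ → (ℋ : Family) →
    (Σ ℕ λ c → ∀ G → Free ℋ G → numSdeg≥2 G < c)
      ⇔ (Σ ℕ λ k → 1 ≤ k × (ℋ ≤F Triple (Kstar k) (kP3 k) (K1star k)))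
corollary1p13 em ℋ = mk⇔
  (λ { (C , bounded) → suc C , s≤s z≤n , bounded⇒≤F-models em ℋ C bounded })
  (λ { (zero , () , _)
     ; (suc k′ , _ , ℋ≤models) → cutBound k′ , ≤F-models⇒bounded ℋ k′ ℋ≤models })
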